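{- Let $\Gamma$ be a gain graph with finite gain group $G$, and suppose $\Gamma$ has an induced subgraph $\Gamma[W]$ isomorphic to $\mathring{K}_n^G$ (i.e. $|W|=n$, every vertex of $W$ carries a loop, and $\{u,v\}_g\in E_\Gamma$ for all distinct $u,v\in W$ and all $g\in G$). Then the corresponding flat of $M_\times(\Gamma)$, namely the set of edges and loops of $\Gamma[W]$, is a modular flat of $M_\times(\Gamma)$.
   Context: A gain graph $\Gamma=(V_\Gamma,E_\Gamma,L_\Gamma,G_\Gamma)$ consists of a finite vertex set $V_\Gamma$, a set $L_\Gamma\subseteq V_\Gamma$ of loops, a group $G_\Gamma$, and a finite set $E_\Gamma$ of edges $\{u,v\}_g$ (classes of triples $(u,v,g)$, $u\ne v$, $g\in G_\Gamma$, with $(u,v,g)\sim(v,u,g^{ -1})$). The induced subgraph $\Gamma[W]$ has vertex set $W$, loops $W\cap L_\Gamma$ and edges $\{u,v\}_g\in E_\Gamma$ with $u,v\in W$. A cycle is either a loop or a set of edges $\{v_1,v_2\}_{g_1},\dots,\{v_m,v_1\}_{g_m}$ on distinct vertices, $m\ge 2$ (two distinct edges when $m=2$); it is balanced if $g_1\cdots g_m=1$, loops being unbalanced. The frame matroid $M_\times(\Gamma)$ on $E_\Gamma\sqcup L_\Gamma$: $S$ is independent iff each connected component of $(V_\Gamma,S\cap E_\Gamma,S\cap L_\Gamma,G_\Gamma)$ contains no balanced cycle and at most one unbalanced cycle. $\mathring{K}_n^G$ is the gain graph on $[n]$ with gain group $G$, all edges $\{i,j\}_g$ ($i\ne j$,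 $g\in G$) and a loop at every vertex. A flat $X$ of a matroid with rank function $r$ is modular if $r(X)+r(Y)=r(X\cap Y)+r(\mathrm{cl}(X\cup Y))$ for all flats $Y$. -}

module Defs where

open import Data.Bool using (Bool; true; false; _∧_; _∨_; if_then_else_)
open import Data.Nat using (ℕ; zero; suc; _+_; _≤_; _<_; _<ᵇ_)
open import Data.Fin using (Fin; zero; suc; toℕ)
open import Data.Fin.Properties using (_≟_)
open import Data.List using (List; []; _∷_; allFin; concatMap; map)
open import Data.Product using (Σ; _×_; _,_)
open import Data.Sum using (_⊎_; inj₁; inj₂)
open import Data.Empty using (⊥)
open import Relation.Nullary using (¬_)
open import Relation.Nullary.Decidable using (⌊_⌋)
open import Relation.Binary.PropositionalEquality using (_≡_; _≢_)
open import Relation.Binary.Construct.Closure.ReflexiveTransitive using (Star)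
open import Algebra.Structures using (IsGroup)
open import Function.Definitions using (Injective)

-- Finite groups: every finite group is (isomorphic to) a group structure
-- on Fin k, k = its order, with propositional equality.

record FinGroup : Set where
  field
    order   : ℕ
    _∙_     : Fin order → Fin order → Fin order
    ε       : Fin order
    _⁻¹     : Fin order → Fin order
    isGroup : IsGroup _≡_ _∙_ ε _⁻¹

open FinGroup public

Carrier : FinGroup → Set
Carrier G = Fin (order G)

-- Raw elements over vertex set Fin nv: a triple (u , v , g) represents the
-- edge {u,v}_g (meaningful only when u ≠ v), inj₂ v represents the loop at v.

Elt : FinGroup → ℕ → Set
Elt G nv = (Fin nv × Fin nv × Carrier G) ⊎ Fin nv

count : {A : Set} → (A → Bool) → List A → ℕ
count p [] = 0
count p (x ∷ xs) = (if p x then 1 else 0) + count p xs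

countV : {nv : ℕ} → (Fin nv → Bool) → ℕ
countV {nv} W = count W (allFin nv)

record ESet (G : FinGroup) (nv : ℕ) : Set where
  constructor mkE
  field
    mem : Elt G nv → Bool

open ESet public

module _ {G : FinGroup} {nv : ℕ} where

  _=ᶠ_ : ∀ {m} → Fin m → Fin m → Bool
  a =ᶠ b = ⌊ a ≟ b ⌋

  sameE : Elt G nv → Elt G nv → Bool
  sameE (inj₁ (u , v , g)) (inj₁ (u' , v' , g')) =
    ((u =ᶠ u') ∧ (v =ᶠ v') ∧ (g =ᶠ g')) ∨
    ((u =ᶠ v') ∧ (v =ᶠ u') ∧ (g =ᶠ (_⁻¹ G g')))
  sameE (inj₂ v) (inj₂ v') = v =ᶠ v'
  sameE _ _ = false

  -- A set of edges/loops: a Bool-valued predicate on raw elements that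
  -- respects ~ and contains no raw triple with u ≡ v.

  WF : ESet G nv → Set
  WF S = (∀ e e' → sameE e e' ≡ true → mem S e ≡ mem S e')
       × (∀ u g → mem S (inj₁ (u , u , g)) ≡ false)

  _⊆_ : ESet G nv → ESet G nv → Set
  S ⊆ T = ∀ e → mem S e ≡ true → mem T e ≡ true

  _∪_ : ESet G nv → ESet G nv → ESet G nv
  S ∪ T = mkE λ e → mem S e ∨ mem T e

  _∩_ : ESet G nv → ESet G nv → ESet G nv
  S ∩ T = mkE λ e → mem S e ∧ mem T e

  insert : ESet G nv → Elt G nv → ESet G nv
  insert S e = mkE λ e' → mem S e' ∨ sameE e' e


  allTriples : List (Fin nv × Fin nv × Carrier G)
  allTriples = concatMap (λ u → concatMap (λ v → map (λ g → (u , v , g))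
                 (allFin (order G))) (allFin nv)) (allFin nv)

  -- number of elements of S: each edge class counted once (via u < v)
  size : ESet G nv → ℕ
  size S = count (λ { (u , v , g) → mem S (inj₁ (u , v , g)) ∧ (toℕ u <ᵇ toℕ v) }) allTriples
         + count (λ v → mem S (inj₂ v)) (allFin nv)

  -- cyclic successor on Fin (suc n)
  next : ∀ {n} → Fin (suc n) → Fin (suc n)
  next {zero} zero = zero
  next {suc n} zero = suc zero
  next {suc n} (suc i) with next i
  ... | zero = zero
  ... | suc j = suc (suc j)

  prod : ∀ {m} → (Fin m → Carrier G) → Carrier G
  prod {zero} gs = ε G
  prod {suc m} gs = _∙_ G (gs zero) (prod (λ i → gs (suc i)))

  polyEdge : ∀ {k} → (Fin (suc k) → Fin nv) → (Fin (suc k) → Carrier G)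
           → Fin (suc k) → Elt G nv
  polyEdge vs gs i = inj₁ (vs i , vs (next i) , gs i)

  -- cycles contained in S: a loop, or a polygon v₀ … v_{m-1} (m = k+2 ≥ 2)
  -- on distinct vertices with pairwise distinct edges {v_i,v_{i+1}}_{g_i}
  data Cycle (S : ESet G nv) : Set where
    loopC : (v : Fin nv) → mem S (inj₂ v) ≡ true → Cycle S
    polyC : (k : ℕ) (vs : Fin (suc (suc k)) → Fin nv) → Injective _≡_ _≡_ vs
          → (gs : Fin (suc (suc k)) → Carrier G)
          → (∀ i → mem S (polyEdge vs gs i) ≡ true)
          → (∀ i j → i ≢ j → sameE (polyEdge vs gs i) (polyEdge vs gs j) ≡ false)
          → Cycle S

  Balanced : ∀ {S} → Cycle S → Set
  Balanced (loopC _ _) = ⊥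
  Balanced (polyC k vs _ gs _ _) = prod gs ≡ ε G

  InCycle : ∀ {S} → Cycle S → Elt G nv → Set
  InCycle (loopC v _) e = sameE e (inj₂ v) ≡ true
  InCycle (polyC k vs _ gs _ _) e = Σ (Fin (suc (suc k))) λ i → sameE e (polyEdge vs gs i) ≡ true

  SameEdges : ∀ {S} → Cycle S → Cycle S → Set
  SameEdges C D = ∀ e → (InCycle C e → InCycle D e) × (InCycle D e → InCycle C e)

  OnCycle : ∀ {S} → Cycle S → Fin nv → Set
  OnCycle (loopC v _) x = x ≡ v
  OnCycle (polyC k vs _ gs _ _) x = Σ (Fin (suc (suc k))) λ i → vs i ≡ x

  Adj : ESet G nv → Fin nv → Fin nv → Set
  Adj S u v = Σ (Carrier G) λ g → mem S (inj₁ (u , v , g)) ≡ true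

  Connected : ESet G nv → Fin nv → Fin nv → Set
  Connected S = Star (Adj S)

  SameComponent : ∀ {S} → Cycle S → Cycle S → Set
  SameComponent {S} C D = Σ (Fin nv) λ x → Σ (Fin nv) λ y →
    OnCycle C x × OnCycle D y × Connected S x y

  Independent : ESet G nv → Set
  Independent S =
      (∀ (C : Cycle S) → ¬ Balanced C)
    × (∀ (C D : Cycle S) → ¬ Balanced C → ¬ Balanced D → SameComponent C D → SameEdges C D)

  Rank : ESet G nv → ℕ → Set
  Rank X k =
      Σ (ESet G nv) (λ I → WF I × I ⊆ X × Independent I × size I ≡ k)
    × (∀ I → WF I → I ⊆ X → Independent I → size I ≤ k)

  InClosure : ESet G nv → Elt G nv → Set
  InClosure Z e = ∀ k → Rank Z k → Rank (insert Z e) k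

record GainGraph (G : FinGroup) (nv : ℕ) : Set where
  field
    elts   : ESet G nv
    eltsWF : WF elts

open GainGraph public

module _ {G : FinGroup} {nv : ℕ} where


  IsClosure : GainGraph G nv → ESet G nv → ESet G nv → Set
  IsClosure Γ Z C = WF C × C ⊆ elts Γ
    × (∀ e → mem (elts Γ) e ≡ true → (mem C e ≡ true → InClosure Z e) × (InClosure Z e → mem C e ≡ true))

  Flat : GainGraph G nv → ESet G nv → Set
  Flat Γ X = WF X × X ⊆ elts Γ
    × (∀ e → mem (elts Γ) e ≡ true → InClosure X e → mem X e ≡ true)

  Modular : GainGraph G nv → ESet G nv → Set
  Modular Γ X = Flat Γ X ×
    (∀ Y → Flat Γ Y → ∀ C → IsClosure Γ (X ∪ Y) C →
      ∀ a b c d → Rank X a → Rank Y b → Rank (X ∩ Y) c → Rank C d →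
      a + b ≡ c + d)

  inducedElts : GainGraph G nv → (Fin nv → Bool) → ESet G nv
  inducedElts Γ W = mkE λ
    { (inj₁ (u , v , g)) → W u ∧ W v ∧ mem (elts Γ) (inj₁ (u , v , g))
    ; (inj₂ v) → W v ∧ mem (elts Γ) (inj₂ v) }

module Submission where

-- Adding to an independent set S an element outside its span keeps it independent and lowers by one the
-- number β(S) of balanced components of (V, S); the greedy algorithm therefore gives r(S) = |V| − β(S),
-- and cl(S) has the same β as S.  Modularity of X = E(Γ[W]) thus reduces to
-- β(X) + β(Y) = β(X ∩ Y) + β(X ∪ Y) for flats Y, checked vertex by vertex on the least vertices of
-- components, in an order listing W first.  A vertex of W carries a loop of X, so it represents no
-- balanced component of X or X ∪ Y; it represents one of Y iff of X ∩ Y, since whatever Y spans inside W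
-- (the loop at x, or the edge {w,x}_g recording the gain of a walk) lies in X and, Y being a flat, in Y.
-- A vertex outside W is an isolated balanced component of X and of X ∩ Y, and a balanced component of Y
-- whose least vertex lies outside W never meets W, so it is also a component of X ∪ Y.

open import Defs
open import Algebra.Bundles using (Group)
open import Algebra.Structures using (IsGroup)
import Algebra.Properties.Group as GroupProperties
open import Data.Bool using (Bool; true; false; _∧_; _∨_; not; if_then_else_)
import Data.Bool.Properties as Boolₚ
open import Data.Empty using (⊥; ⊥-elim)
open import Data.Fin using (Fin; zero; suc; toℕ; inject₁; fromℕ)
open import Data.Fin.Properties using (_≟_; any?; all?)
import Data.Fin.Properties as Finₚ
open import Data.List using (List; []; _∷_; _++_; allFin; concatMap; map; tabulate; length)
import Data.List.Properties as Listₚ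
open import Data.List.Membership.Propositional using (_∈_)
import Data.List.Membership.Propositional.Properties as ∈ₚ
open import Data.List.Relation.Unary.Any using (here; there)
open import Data.Nat using (ℕ; zero; suc; _+_; _∸_; _≤_; _<_; _<ᵇ_; z≤n; s≤s; _<?_)
import Data.Nat.Properties as ℕₚ
open import Algebra.Properties.CommutativeSemigroup ℕₚ.+-commutativeSemigroup using () renaming (interchange to +-interchange)
open import Data.Product using (Σ; _×_; _,_; proj₁; proj₂)
open import Data.Product.Properties using (≡-dec)
open import Data.Sum using (_⊎_; inj₁; inj₂; [_,_])
open import Data.Unit using (⊤; tt)
open import Function.Definitions using (Injective)
open import Level using (0ℓ)
open import Relation.Binary.Construct.Closure.ReflexiveTransitive using (_◅_) renaming (ε to sε)
open import Relation.Binary.Definitions using (tri<; tri≈; tri>)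
open import Relation.Binary.PropositionalEquality using (_≡_; _≢_; refl; sym; trans; cong; cong₂; subst; subst₂)
open import Relation.Nullary using (¬_; Dec; yes; no)
open import Relation.Nullary.Decidable using (⌊_⌋; _×-dec_; ¬?; _→-dec_)

module GroupLemmas (G : FinGroup) where
  open FinGroup G public using () renaming (_∙_ to _·_; ε to e; _⁻¹ to inv)
  open IsGroup (isGroup G) public using (assoc; identityˡ; identityʳ; inverseˡ; inverseʳ)

  group : Group 0ℓ 0ℓ
  group = record { Carrier = Carrier G ; _≈_ = _≡_ ; _∙_ = _∙_ G ; ε = ε G ; _⁻¹ = _⁻¹ G ; isGroup = isGroup G }

  open GroupProperties group public using (inverseˡ-unique; inverseʳ-unique; ε⁻¹≈ε; ⁻¹-involutive; ⁻¹-anti-homo-∙; x∙y⁻¹≈ε⇒x≈y; ∙-cancelˡ)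

  rotate-ε : ∀ a b → a · b ≡ e → b · a ≡ e
  rotate-ε a b p = trans (cong (_· a) (inverseʳ-unique a b p)) (inverseˡ a)

  conjugate-ε : ∀ p c → (p · c) · inv p ≡ e → c ≡ e
  conjugate-ε p c h = ∙-cancelˡ p c e (trans (inverseˡ-unique (p · c) (inv p) h) (trans (⁻¹-involutive p) (sym (identityʳ p))))

⌊≟⌋-refl : ∀ {m} (a : Fin m) → ⌊ a ≟ a ⌋ ≡ true
⌊≟⌋-refl a with a ≟ a
... | yes _ = refl
... | no ¬p = ⊥-elim (¬p refl)

⌊≟⌋-sound : ∀ {m} (a b : Fin m) → ⌊ a ≟ b ⌋ ≡ true → a ≡ b
⌊≟⌋-sound a b p with a ≟ b
... | yes q = q
⌊≟⌋-sound a b () | no _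

⌊≟⌋-false : ∀ {m} {a b : Fin m} → a ≢ b → ⌊ a ≟ b ⌋ ≡ false
⌊≟⌋-false {a = a} {b} ne with a ≟ b
... | yes q = ⊥-elim (ne q)
... | no _ = refl

∧-true : ∀ {a b} → a ∧ b ≡ true → a ≡ true × b ≡ true
∧-true {a} {b} p = Boolₚ.∧-conicalˡ a b p , Boolₚ.∧-conicalʳ a b p

∨-true : ∀ {a b} → a ∨ b ≡ true → a ≡ true ⊎ b ≡ true
∨-true {true} _ = inj₁ refl
∨-true {false} p = inj₂ p

∨-introˡ : ∀ {a} b → a ≡ true → a ∨ b ≡ true
∨-introˡ b refl = refl

∨-introʳ : ∀ a {b} → b ≡ true → a ∨ b ≡ true
∨-introʳ true _ = refl
∨-introʳ false p = p

∧-intro : ∀ {a b} → a ≡ true → b ≡ true → a ∧ b ≡ true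
∧-intro refl refl = refl

true≢false : true ≢ false
true≢false ()

bool-cases : (b : Bool) → b ≡ true ⊎ b ≡ false
bool-cases true = inj₁ refl
bool-cases false = inj₂ refl

not-true : ∀ {b} → b ≢ true → b ≡ false
not-true {true} p = ⊥-elim (p refl)
not-true {false} _ = refl

dec-agree : ∀ {P Q : Set} (d : Dec P) (d' : Dec Q) → (P → Q) → (Q → P) → ⌊ d ⌋ ≡ ⌊ d' ⌋
dec-agree (yes p) (yes q) f g = refl
dec-agree (no np) (no nq) f g = refl
dec-agree (yes p) (no nq) f g = ⊥-elim (nq (f p))
dec-agree (no np) (yes q) f g = ⊥-elim (np (g q))

dec-true : ∀ {P : Set} (d : Dec P) → P → ⌊ d ⌋ ≡ true
dec-true (yes _) _ = refl
dec-true (no n) p = ⊥-elim (n p)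

dec-false : ∀ {P : Set} (d : Dec P) → ¬ P → ⌊ d ⌋ ≡ false
dec-false (yes p) n = ⊥-elim (n p)
dec-false (no _) _ = refl

dec-sound : ∀ {P : Set} (d : Dec P) → ⌊ d ⌋ ≡ true → P
dec-sound (yes p) _ = p
dec-sound (no _) ()

module _ {A : Set} where
  count-ext : ∀ {p q : A → Bool} → (∀ x → p x ≡ q x) → ∀ xs → count p xs ≡ count q xs
  count-ext h [] = refl
  count-ext {p} {q} h (x ∷ xs) = cong₂ _+_ (cong (λ b → if b then 1 else 0) (h x)) (count-ext h xs)

  count-++ : ∀ (p : A → Bool) xs ys → count p (xs ++ ys) ≡ count p xs + count p ys
  count-++ p [] ys = refl
  count-++ p (x ∷ xs) ys = trans (cong ((if p x then 1 else 0) +_) (count-++ p xs ys)) (sym (ℕₚ.+-assoc (if p x then 1 else 0) _ _))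

  count-mono : ∀ {p q : A → Bool} → (∀ x → p x ≡ true → q x ≡ true) → ∀ xs → count p xs ≤ count q xs
  count-mono h [] = z≤n
  count-mono {p} {q} h (x ∷ xs) with bool-cases (p x) | bool-cases (q x)
  ... | inj₁ px | inj₁ qx rewrite px | qx = s≤s (count-mono h xs)
  ... | inj₁ px | inj₂ qx = ⊥-elim (true≢false (trans (sym (h x px)) qx))
  ... | inj₂ px | inj₁ qx rewrite px | qx = ℕₚ.≤-trans (count-mono h xs) (ℕₚ.n≤1+n _)
  ... | inj₂ px | inj₂ qx rewrite px | qx = count-mono h xs

  count-≤-len : ∀ (p : A → Bool) xs → count p xs ≤ length xs
  count-≤-len p [] = z≤n
  count-≤-len p (x ∷ xs) with p x
  ... | true = s≤s (count-≤-len p xs)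
  ... | false = ℕₚ.≤-trans (count-≤-len p xs) (ℕₚ.n≤1+n _)

  count-diff : (deq : (x y : A) → Dec (x ≡ y)) (t : A) {p q : A → Bool} → p t ≡ false → q t ≡ true →
               (∀ x → x ≢ t → p x ≡ q x) → ∀ xs → count q xs ≡ count p xs + count (λ x → ⌊ deq x t ⌋) xs
  count-diff deq t pt qt h [] = refl
  count-diff deq t {p} {q} pt qt h (x ∷ xs) with deq x t
  ... | yes refl rewrite pt | qt = trans (cong suc (count-diff deq t pt qt h xs)) (sym (ℕₚ.+-suc _ _))
  ... | no ne rewrite h x ne = trans (cong ((if q x then 1 else 0) +_) (count-diff deq t pt qt h xs)) (sym (ℕₚ.+-assoc (if q x then 1 else 0) _ _))

count-false : ∀ {A : Set} (p : A → Bool) → (∀ x → p x ≡ false) → ∀ xs → count p xs ≡ 0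
count-false p h [] = refl
count-false p h (x ∷ xs) rewrite h x = count-false p h xs

∧-false-left : ∀ a b → a ∧ b ≡ false → b ≡ true → a ≡ false
∧-false-left false b _ _ = refl
∧-false-left true b p q = trans (sym q) p

∸-modular : ∀ n p q r s → p ≤ n → q ≤ n → r ≤ n → s ≤ n → p + q ≡ r + s → (n ∸ p) + (n ∸ q) ≡ (n ∸ r) + (n ∸ s)
∸-modular n p q r s p≤n q≤n r≤n s≤n eq =
  ℕₚ.+-cancelʳ-≡ (p + q) _ _ (trans (complement p q p≤n q≤n) (trans (sym (complement r s r≤n s≤n)) (cong ((n ∸ r) + (n ∸ s) +_) (sym eq))))
  where
  complement : ∀ x y → x ≤ n → y ≤ n → ((n ∸ x) + (n ∸ y)) + (x + y) ≡ n + n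
  complement x y x≤n y≤n = trans (+-interchange (n ∸ x) (n ∸ y) x y) (cong₂ _+_ (ℕₚ.m∸n+n≡m x≤n) (ℕₚ.m∸n+n≡m y≤n))

count-+-pointwise : ∀ {A : Set} (p q r s : A → Bool) →
  (∀ x → (if p x then 1 else 0) + (if q x then 1 else 0) ≡ (if r x then 1 else 0) + (if s x then 1 else 0)) →
  ∀ xs → count p xs + count q xs ≡ count r xs + count s xs
count-+-pointwise p q r s h [] = refl
count-+-pointwise p q r s h (x ∷ xs) =
  trans (+-interchange (ind p) (count p xs) (ind q) (count q xs))
    (trans (cong₂ _+_ (h x) (count-+-pointwise p q r s h xs)) (sym (+-interchange (ind r) (count r xs) (ind s) (count s xs))))
  where
  ind : (_ → Bool) → ℕ
  ind t = if t x then 1 else 0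

sumList : ∀ {A : Set} → (A → ℕ) → List A → ℕ
sumList F [] = 0
sumList F (x ∷ xs) = F x + sumList F xs

sumFin : ∀ {n} → (Fin n → ℕ) → ℕ
sumFin {zero} H = 0
sumFin {suc n} H = H zero + sumFin (λ i → H (suc i))

sumList-tabulate : ∀ {A : Set} {n} (F : A → ℕ) (g : Fin n → A) → sumList F (tabulate g) ≡ sumFin (λ i → F (g i))
sumList-tabulate {n = zero} F g = refl
sumList-tabulate {n = suc n} F g = cong (F (g zero) +_) (sumList-tabulate F (λ i → g (suc i)))

sumFin-zero : ∀ {n} (H : Fin n → ℕ) → (∀ i → H i ≡ 0) → sumFin H ≡ 0
sumFin-zero {zero} H h = refl
sumFin-zero {suc n} H h = cong₂ _+_ (h zero) (sumFin-zero _ (λ i → h (suc i)))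

sumFin-single : ∀ {n} (H : Fin n → ℕ) (a : Fin n) → (∀ i → i ≢ a → H i ≡ 0) → sumFin H ≡ H a
sumFin-single {suc n} H zero h = trans (cong (H zero +_) (sumFin-zero (λ i → H (suc i)) (λ i → h (suc i) (λ ())))) (ℕₚ.+-identityʳ _)
sumFin-single {suc n} H (suc a) h = trans (cong (_+ sumFin (λ i → H (suc i))) (h zero (λ ()))) (sumFin-single (λ i → H (suc i)) a (λ i ne → h (suc i) (λ p → ne (Finₚ.suc-injective p))))

count-map : ∀ {A B : Set} (p : B → Bool) (f : A → B) xs → count p (map f xs) ≡ count (λ x → p (f x)) xs
count-map p f [] = refl
count-map p f (x ∷ xs) = cong (_ +_) (count-map p f xs)

count-concatMap : ∀ {A B : Set} (p : B → Bool) (f : A → List B) xs → count p (concatMap f xs) ≡ sumList (λ x → count p (f x)) xs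
count-concatMap p f [] = refl
count-concatMap p f (x ∷ xs) = trans (count-++ p (f x) (concatMap f xs)) (cong (count p (f x) +_) (count-concatMap p f xs))

count-sum : ∀ {A : Set} (p : A → Bool) xs → count p xs ≡ sumList (λ x → if p x then 1 else 0) xs
count-sum p [] = refl
count-sum p (x ∷ xs) = cong (_ +_) (count-sum p xs)

count-allFin-single : ∀ {n} (p : Fin n → Bool) (a : Fin n) → p a ≡ true → (∀ i → i ≢ a → p i ≡ false) → count p (allFin n) ≡ 1
count-allFin-single {n} p a pa h = trans (count-sum p (allFin n)) (trans (sumList-tabulate {n = n} (λ x → if p x then 1 else 0) (λ i → i)) (trans (sumFin-single _ a (λ i ne → cong (λ b → if b then 1 else 0) (h i ne))) (cong (λ b → if b then 1 else 0) pa)))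

module EdgeSets (G : FinGroup) (nv : ℕ) where
  open GroupLemmas G
  V = Fin nv
  E = Elt G nv
  Gr = Carrier G

  sameEdge : E → E → Bool
  sameEdge = sameE {G} {nv}

  data Same : E → E → Set where
    sfwd : ∀ {u v g} → Same (inj₁ (u , v , g)) (inj₁ (u , v , g))
    sbwd : ∀ {u v g g'} → g ≡ inv g' → Same (inj₁ (u , v , g)) (inj₁ (v , u , g'))
    sloop : ∀ {v} → Same (inj₂ v) (inj₂ v)

  sameEdge⇒Same : ∀ e e' → sameEdge e e' ≡ true → Same e e'
  sameEdge⇒Same (inj₁ (u , v , g)) (inj₁ (u' , v' , g')) p with ∨-true p
  ... | inj₁ q with ∧-true q
  ... | q1 , q2 with ∧-true q2
  ... | q3 , q4 with ⌊≟⌋-sound u u' q1 | ⌊≟⌋-sound v v' q3 | ⌊≟⌋-sound g g' q4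
  ... | refl | refl | refl = sfwd
  sameEdge⇒Same (inj₁ (u , v , g)) (inj₁ (u' , v' , g')) p | inj₂ q with ∧-true q
  ... | q1 , q2 with ∧-true q2
  ... | q3 , q4 with ⌊≟⌋-sound u v' q1 | ⌊≟⌋-sound v u' q3 | ⌊≟⌋-sound g (inv g') q4
  ... | refl | refl | r = sbwd r
  sameEdge⇒Same (inj₂ v) (inj₂ v') p with ⌊≟⌋-sound v v' p
  ... | refl = sloop

  Same⇒sameEdge : ∀ {e e'} → Same e e' → sameEdge e e' ≡ true
  Same⇒sameEdge (sfwd {u} {v} {g}) rewrite ⌊≟⌋-refl u | ⌊≟⌋-refl v | ⌊≟⌋-refl g = refl
  Same⇒sameEdge (sbwd {u} {v} {g} {g'} refl) =
    ∨-introʳ (⌊ u ≟ v ⌋ ∧ ⌊ v ≟ u ⌋ ∧ ⌊ _⁻¹ G g' ≟ g' ⌋) (∧-intro (⌊≟⌋-refl u) (∧-intro (⌊≟⌋-refl v) (⌊≟⌋-refl (_⁻¹ G g'))))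
  Same⇒sameEdge (sloop {v}) = ⌊≟⌋-refl v

  Same-refl : ∀ e → Same e e
  Same-refl (inj₁ _) = sfwd
  Same-refl (inj₂ _) = sloop

  Same-sym : ∀ {e e'} → Same e e' → Same e' e
  Same-sym sfwd = sfwd
  Same-sym (sbwd {g = g} {g'} p) = sbwd (trans (sym (⁻¹-involutive g')) (cong (inv) (sym p)))
  Same-sym sloop = sloop

  Same-trans : ∀ {a b c} → Same a b → Same b c → Same a c
  Same-trans sfwd q = q
  Same-trans (sbwd p) sfwd = sbwd p
  Same-trans (sbwd {u} {v} {g} {g'} p) (sbwd {g' = g''} q) =
    subst (λ x → Same (inj₁ (u , v , g)) (inj₁ (u , v , x))) (trans p (trans (cong (inv) q) (⁻¹-involutive g''))) sfwd
  Same-trans sloop sloop = sloop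

  sameEdge-sym : ∀ e e' → sameEdge e e' ≡ true → sameEdge e' e ≡ true
  sameEdge-sym e e' p = Same⇒sameEdge (Same-sym (sameEdge⇒Same e e' p))

  sameEdge-trans : ∀ a b c → sameEdge a b ≡ true → sameEdge b c ≡ true → sameEdge a c ≡ true
  sameEdge-trans a b c p q = Same⇒sameEdge (Same-trans (sameEdge⇒Same a b p) (sameEdge⇒Same b c q))

  sameEdge-congˡ : ∀ a b c → sameEdge a b ≡ true → sameEdge a c ≡ sameEdge b c
  sameEdge-congˡ a b c p with bool-cases (sameEdge a c) | bool-cases (sameEdge b c)
  ... | inj₁ x | inj₁ y = trans x (sym y)
  ... | inj₂ x | inj₂ y = trans x (sym y)
  ... | inj₁ x | inj₂ y = ⊥-elim (true≢false (trans (sym (sameEdge-trans b a c (sameEdge-sym a b p) x)) y))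
  ... | inj₂ x | inj₁ y = ⊥-elim (true≢false (trans (sym (sameEdge-trans a b c p y)) x))

  sameEdge-flip : ∀ u v g → sameEdge (inj₁ (u , v , g)) (inj₁ (v , u , inv g)) ≡ true
  sameEdge-flip u v g = Same⇒sameEdge {inj₁ (u , v , g)} {inj₁ (v , u , inv g)} (sbwd (sym (⁻¹-involutive g)))

  NonDegenerate : E → Set
  NonDegenerate (inj₁ (a , b , _)) = a ≢ b
  NonDegenerate (inj₂ _) = ⊤

  _≐_ : ESet G nv → ESet G nv → Set
  S ≐ T = ∀ e → mem S e ≡ mem T e

  mem-flip : ∀ {S : ESet G nv} → WF S → ∀ u v g → mem S (inj₁ (u , v , g)) ≡ mem S (inj₁ (v , u , inv g))
  mem-flip wf u v g = proj₁ wf _ _ (sameEdge-flip u v g)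

  mem-flip⁺ : ∀ {S : ESet G nv} → WF S → ∀ {u v g} → mem S (inj₁ (u , v , g)) ≡ true → mem S (inj₁ (v , u , inv g)) ≡ true
  mem-flip⁺ wf {u} {v} {g} p = trans (sym (mem-flip wf u v g)) p

  remove : ESet G nv → E → ESet G nv
  remove S e = mkE λ e' → mem S e' ∧ not (sameEdge e' e)

  ⊆-refl : ∀ {S : ESet G nv} → S ⊆ S
  ⊆-refl e p = p

  ⊆-trans : ∀ {S T U : ESet G nv} → S ⊆ T → T ⊆ U → S ⊆ U
  ⊆-trans p q e r = q e (p e r)

  insert-⊆ : ∀ {S : ESet G nv} e → S ⊆ insert S e
  insert-⊆ {S} e e' p = ∨-introˡ (sameEdge e' e) p

  insert-has : ∀ (S : ESet G nv) e → mem (insert S e) e ≡ true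
  insert-has S e = ∨-introʳ (mem S e) (Same⇒sameEdge (Same-refl e))

  remove-⊆ : ∀ {S : ESet G nv} e → remove S e ⊆ S
  remove-⊆ e e' p = proj₁ (∧-true p)

  WF-insert : ∀ {S : ESet G nv} → WF S → ∀ e → NonDegenerate e → WF (insert S e)
  WF-insert {S} wf e nd = (λ a b p → cong₂ _∨_ (proj₁ wf a b p) (sameEdge-congˡ a b e p)) , nd'
    where
    nd' : ∀ u g → mem S (inj₁ (u , u , g)) ∨ sameEdge (inj₁ (u , u , g)) e ≡ false
    nd' u g rewrite proj₂ wf u g = not-true (λ q → nd-lem (sameEdge⇒Same _ _ q) nd)
      where
      nd-lem : ∀ {e'} → Same (inj₁ (u , u , g)) e' → NonDegenerate e' → ⊥
      nd-lem sfwd n = n refl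
      nd-lem (sbwd _) n = n refl

  WF-remove : ∀ {S : ESet G nv} → WF S → ∀ e → WF (remove S e)
  WF-remove {S} wf e = (λ a b p → cong₂ _∧_ (proj₁ wf a b p) (cong not (sameEdge-congˡ a b e p))) ,
    (λ u g → cong (_∧ _) (proj₂ wf u g))

  WF-∪ : ∀ {S T : ESet G nv} → WF S → WF T → WF (S ∪ T)
  WF-∪ wS wT = (λ a b p → cong₂ _∨_ (proj₁ wS a b p) (proj₁ wT a b p)) ,
    (λ u g → cong₂ _∨_ (proj₂ wS u g) (proj₂ wT u g))

  WF-∩ : ∀ {S T : ESet G nv} → WF S → WF T → WF (S ∩ T)
  WF-∩ wS wT = (λ a b p → cong₂ _∧_ (proj₁ wS a b p) (proj₁ wT a b p)) ,
    (λ u g → cong (_∧ _) (proj₂ wS u g))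

  Triple = V × V × Gr

  _≟T_ : (x y : Triple) → Dec (x ≡ y)
  _≟T_ = ≡-dec _≟_ (≡-dec _≟_ _≟_)

  edgeCounted : ESet G nv → Triple → Bool
  edgeCounted S (u , v , g) = mem S (inj₁ (u , v , g)) ∧ (toℕ u <ᵇ toℕ v)

  loopCounted : ESet G nv → V → Bool
  loopCounted S v = mem S (inj₂ v)

  allTriplesAt : List Triple
  allTriplesAt = allTriples {G} {nv}

  size-split : ∀ (S : ESet G nv) → size S ≡ count (edgeCounted S) allTriplesAt + count (loopCounted S) (allFin nv)
  size-split S = cong (_+ count (loopCounted S) (allFin nv)) (count-ext (λ { (u , v , g) → refl }) allTriplesAt)

  size-ext : ∀ {S T : ESet G nv} → S ≐ T → size S ≡ size T
  size-ext {S} {T} h = trans (size-split S) (trans (cong₂ _+_ (count-ext (λ { (u , v , g) → cong (_∧ _) (h _) }) allTriplesAt)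
    (count-ext (λ v → h (inj₂ v)) (allFin nv))) (sym (size-split T)))

  allTriples-occurs-once : ∀ (t : Triple) → count (λ x → ⌊ x ≟T t ⌋) allTriplesAt ≡ 1
  allTriples-occurs-once (a , b , h) =
    trans (count-concatMap ind triplesAt (allFin nv))
    (trans (sumList-tabulate {n = nv} (λ u → count ind (triplesAt u)) (λ i → i))
    (trans (sumFin-single _ a (λ u ne → outer0 u ne)) (inner-a)))
    where
    ind : Triple → Bool
    ind x = ⌊ x ≟T (a , b , h) ⌋
    triplesFrom : V → V → List Triple
    triplesFrom u v = map (λ g → (u , v , g)) (allFin (order G))
    triplesAt : V → List Triple
    triplesAt u = concatMap (triplesFrom u) (allFin nv)
    ind-false : ∀ x → x ≢ (a , b , h) → ind x ≡ false
    ind-false x ne with x ≟T (a , b , h)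
    ... | yes p = ⊥-elim (ne p)
    ... | no _ = refl
    sumL-zero : ∀ {A : Set} (F : A → ℕ) → (∀ x → F x ≡ 0) → ∀ xs → sumList F xs ≡ 0
    sumL-zero F z [] = refl
    sumL-zero F z (x ∷ xs) rewrite z x = sumL-zero F z xs
    ind-true : ind (a , b , h) ≡ true
    ind-true with (a , b , h) ≟T (a , b , h)
    ... | yes _ = refl
    ... | no n = ⊥-elim (n refl)
    inner0 : ∀ u v → (u , v) ≢ (a , b) → count ind (triplesFrom u v) ≡ 0
    inner0 u v ne = trans (count-map ind (λ g → (u , v , g)) (allFin (order G)))
      (count-false (λ g → ind (u , v , g)) (λ g → ind-false _ (λ p → ne (cong (λ { (x , y , _) → (x , y) }) p))) (allFin (order G)))
    outer0 : ∀ u → u ≢ a → count ind (triplesAt u) ≡ 0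
    outer0 u ne = trans (count-concatMap ind (triplesFrom u) (allFin nv))
      (sumL-zero (λ v → count ind (triplesFrom u v)) (λ v → inner0 u v (λ p → ne (cong proj₁ p))) (allFin nv))
    inner-a : count ind (triplesAt a) ≡ 1
    inner-a = trans (count-concatMap ind (triplesFrom a) (allFin nv))
      (trans (sumList-tabulate {n = nv} (λ v → count ind (triplesFrom a v)) (λ i → i))
      (trans (sumFin-single _ b (λ v ne → inner0 a v (λ p → ne (cong proj₂ p))))
      (trans (count-map ind (λ g → (a , b , g)) (allFin (order G)))
      (count-allFin-single (λ g → ind (a , b , g)) h ind-true (λ g ne → ind-false _ (λ p → ne (cong (λ { (_ , _ , z) → z }) p)))))))

  <⇒<ᵇ≡true : ∀ {m n} → m < n → (m <ᵇ n) ≡ true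
  <⇒<ᵇ≡true {zero} {suc n} _ = refl
  <⇒<ᵇ≡true {suc m} {suc n} (s≤s p) = <⇒<ᵇ≡true p

  <ᵇ≡true⇒< : ∀ m n → (m <ᵇ n) ≡ true → m < n
  <ᵇ≡true⇒< zero (suc n) _ = s≤s z≤n
  <ᵇ≡true⇒< (suc m) (suc n) p = s≤s (<ᵇ≡true⇒< m n p)
  <ᵇ≡true⇒< zero zero ()
  <ᵇ≡true⇒< (suc m) zero ()

  <ᵇ-asym : ∀ m n → (m <ᵇ n) ≡ true → (n <ᵇ m) ≡ false
  <ᵇ-asym m n p with bool-cases (n <ᵇ m)
  ... | inj₂ q = q
  ... | inj₁ q = ⊥-elim (ℕₚ.<-asym (<ᵇ≡true⇒< m n p) (<ᵇ≡true⇒< n m q))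

  private
    size-insert-edge< : ∀ {S : ESet G nv} → WF S → ∀ a b h → a ≢ b → mem S (inj₁ (a , b , h)) ≡ false
      → (toℕ a <ᵇ toℕ b) ≡ true → count (edgeCounted (insert S (inj₁ (a , b , h)))) allTriplesAt ≡ suc (count (edgeCounted S) allTriplesAt)
    size-insert-edge< {S} wf a b h ne notin ab =
      trans (count-diff _≟T_ (a , b , h) pt qt diff allTriplesAt) (trans (cong (count (edgeCounted S) allTriplesAt +_) (allTriples-occurs-once _)) (ℕₚ.+-comm _ 1))
      where
      ed = inj₁ (a , b , h)
      pt : edgeCounted S (a , b , h) ≡ false
      pt rewrite notin = refl
      qt : edgeCounted (insert S ed) (a , b , h) ≡ true
      qt = ∧-intro (insert-has S ed) ab
      diff : ∀ x → x ≢ (a , b , h) → edgeCounted S x ≡ edgeCounted (insert S ed) x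
      diff (u , v , g) nx with bool-cases (sameEdge (inj₁ (u , v , g)) ed)
      ... | inj₂ q rewrite q = cong (_∧ (toℕ u <ᵇ toℕ v)) (sym (Boolₚ.∨-identityʳ _))
      ... | inj₁ q with sameEdge⇒Same (inj₁ (u , v , g)) ed q
      ... | sfwd = ⊥-elim (nx refl)
      ... | sbwd _ rewrite <ᵇ-asym (toℕ a) (toℕ b) ab = trans (Boolₚ.∧-zeroʳ _) (sym (Boolₚ.∧-zeroʳ _))

  sameEdge-congʳ : ∀ x a b → sameEdge a b ≡ true → sameEdge x a ≡ sameEdge x b
  sameEdge-congʳ x a b p with bool-cases (sameEdge x a) | bool-cases (sameEdge x b)
  ... | inj₁ u | inj₁ w = trans u (sym w)
  ... | inj₂ u | inj₂ w = trans u (sym w)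
  ... | inj₁ u | inj₂ w = ⊥-elim (true≢false (trans (sym (sameEdge-trans x a b u p)) w))
  ... | inj₂ u | inj₁ w = ⊥-elim (true≢false (trans (sym (sameEdge-trans x b a w (sameEdge-sym a b p))) u))

  insert-cong : ∀ (S : ESet G nv) a b → sameEdge a b ≡ true → insert S a ≐ insert S b
  insert-cong S a b p x = cong (mem S x ∨_) (sameEdge-congʳ x a b p)

  size-insert : ∀ {S : ESet G nv} → WF S → ∀ ed → NonDegenerate ed → mem S ed ≡ false → size (insert S ed) ≡ suc (size S)
  size-insert {S} wf (inj₁ (a , b , h)) nd notin with ℕₚ.<-cmp (toℕ a) (toℕ b)
  ... | tri≈ _ eq _ = ⊥-elim (nd (Finₚ.toℕ-injective eq))
  ... | tri< lt _ _ = trans (size-split (insert S (inj₁ (a , b , h)))) (trans (cong₂ _+_ (size-insert-edge< wf a b h nd notin (<⇒<ᵇ≡true lt)) loops) (sym (cong suc (size-split S))))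
    where
    loops : count (loopCounted (insert S (inj₁ (a , b , h)))) (allFin nv) ≡ count (loopCounted S) (allFin nv)
    loops = count-ext (λ v → Boolₚ.∨-identityʳ _) (allFin nv)
  ... | tri> _ _ gt = trans (size-ext {insert S (inj₁ (a , b , h))} {insert S (inj₁ (b , a , inv h))} (insert-cong S _ _ (sameEdge-flip a b h)))
      (trans (size-split (insert S (inj₁ (b , a , inv h)))) (trans (cong₂ _+_ (size-insert-edge< wf b a (inv h) (λ q → nd (sym q)) (trans (sym (mem-flip wf a b h)) notin) (<⇒<ᵇ≡true gt)) loops) (sym (cong suc (size-split S)))))
    where
    loops : count (loopCounted (insert S (inj₁ (b , a , inv h)))) (allFin nv) ≡ count (loopCounted S) (allFin nv)
    loops = count-ext (λ v → Boolₚ.∨-identityʳ _) (allFin nv)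
  size-insert {S} wf (inj₂ w) nd notin = trans (size-split (insert S (inj₂ w))) (trans (cong₂ _+_ trips loops) (trans (ℕₚ.+-suc _ _) (sym (cong suc (size-split S)))))
    where
    trips : count (edgeCounted (insert S (inj₂ w))) allTriplesAt ≡ count (edgeCounted S) allTriplesAt
    trips = count-ext (λ { (u , v , g) → cong (_∧ (toℕ u <ᵇ toℕ v)) (Boolₚ.∨-identityʳ _) }) allTriplesAt
    loops : count (loopCounted (insert S (inj₂ w))) (allFin nv) ≡ suc (count (loopCounted S) (allFin nv))
    loops = trans (count-diff _≟_ w {p = loopCounted S} {q = loopCounted (insert S (inj₂ w))} notin (insert-has S (inj₂ w)) (λ x nx → trans (sym (Boolₚ.∨-identityʳ _)) (cong (mem S (inj₂ x) ∨_) (sym (⌊≟⌋-false nx)))) (allFin nv))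
      (trans (cong (count (loopCounted S) (allFin nv) +_) (count-allFin-single (λ x → ⌊ x ≟ w ⌋) w (⌊≟⌋-refl w) (λ x nx → ⌊≟⌋-false nx))) (ℕₚ.+-comm _ 1))

  sameEdge-refl : ∀ x → sameEdge x x ≡ true
  sameEdge-refl x = Same⇒sameEdge (Same-refl x)

  sameEdge-ends : ∀ u v g u' v' g' → sameEdge (inj₁ (u , v , g)) (inj₁ (u' , v' , g')) ≡ true →
    (u ≡ u' × v ≡ v' × g ≡ g') ⊎ (u ≡ v' × v ≡ u' × g ≡ inv g')
  sameEdge-ends u v g u' v' g' q with sameEdge⇒Same (inj₁ (u , v , g)) (inj₁ (u' , v' , g')) q
  ... | sfwd = inj₁ (refl , refl , refl)
  ... | sbwd r = inj₂ (refl , refl , r)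

module Walks (G : FinGroup) (nv : ℕ) where
  open GroupLemmas G
  open EdgeSets G nv

  data Walk (S : ESet G nv) : V → V → Set where
    [] : ∀ {x} → Walk S x x
    st : ∀ {x} y (h : Gr) → mem S (inj₁ (x , y , h)) ≡ true → ∀ {z} → Walk S y z → Walk S x z

  module _ {S : ESet G nv} where
    gain : ∀ {x y} → Walk S x y → Gr
    gain [] = e
    gain (st y h p w) = h · gain w

    len : ∀ {x y} → Walk S x y → ℕ
    len [] = 0
    len (st y h p w) = suc (len w)

    _++W_ : ∀ {x y z} → Walk S x y → Walk S y z → Walk S x z
    [] ++W v = v
    st y h p w ++W v = st y h p (w ++W v)

    gain-++ : ∀ {x y z} (w : Walk S x y) (v : Walk S y z) → gain (w ++W v) ≡ gain w · gain v
    gain-++ [] v = sym (identityˡ (gain v))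
    gain-++ (st y h p w) v = trans (cong (h ·_) (gain-++ w v)) (sym (assoc h (gain w) (gain v)))

    len-++ : ∀ {x y z} (w : Walk S x y) (v : Walk S y z) → len (w ++W v) ≡ len w + len v
    len-++ [] v = refl
    len-++ (st y h p w) v = cong suc (len-++ w v)

    module _ (wf : WF S) where
      rev : ∀ {x y} → Walk S x y → Walk S y x
      rev [] = []
      rev {x} (st y h p w) = rev w ++W st x (inv h) (mem-flip⁺ wf p) []

      gain-rev : ∀ {x y} (w : Walk S x y) → gain (rev w) ≡ inv (gain w)
      gain-rev [] = sym ε⁻¹≈ε
      gain-rev {x} (st y h p w) = trans (gain-++ (rev w) (st x (inv h) (mem-flip⁺ wf p) []))
        (trans (cong₂ _·_ (gain-rev w) (identityʳ (inv h))) (sym (⁻¹-anti-homo-∙ h (gain w))))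

  mapWalk : ∀ {S T : ESet G nv} → S ⊆ T → ∀ {x y} → Walk S x y → Walk T x y
  mapWalk sub [] = []
  mapWalk sub (st y h p w) = st y h (sub _ p) (mapWalk sub w)

  gain-mapWalk : ∀ {S T : ESet G nv} (sub : S ⊆ T) {x y} (w : Walk S x y) → gain (mapWalk sub w) ≡ gain w
  gain-mapWalk sub [] = refl
  gain-mapWalk sub (st y h p w) = cong (h ·_) (gain-mapWalk sub w)

  star→walk : ∀ {S : ESet G nv} {x y} → Connected S x y → Walk S x y
  star→walk sε = []
  star→walk ((h , p) ◅ s) = st _ h p (star→walk s)

  walk→star : ∀ {S : ESet G nv} {x y} → Walk S x y → Connected S x y
  walk→star [] = sε
  walk→star (st y h p w) = (h , p) ◅ walk→star w

  -- Unbalancedness of a component is phrased with walks; unbalanced⇒cycle recovers an unbalanced cycle.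
  Unbalanced : ESet G nv → V → Set
  Unbalanced S x = (Σ V λ y → Walk S x y × mem S (inj₂ y) ≡ true) ⊎ (Σ (Walk S x x) λ c → gain c ≢ e)

  -- Span S e is membership of e in the closure of S (see Closure).
  Span : ESet G nv → E → Set
  Span S (inj₂ v) = Unbalanced S v
  Span S (inj₁ (u , v , h)) = (Unbalanced S u × Unbalanced S v) ⊎ (Walk S u v × Unbalanced S u) ⊎ (Σ (Walk S u v) λ w → gain w ≡ h)

  module _ {S : ESet G nv} (wf : WF S) where
    unbalanced-transport : ∀ {x y} → Walk S x y → Unbalanced S y → Unbalanced S x
    unbalanced-transport w (inj₁ (z , w' , l)) = inj₁ (z , w ++W w' , l)
    unbalanced-transport w (inj₂ (c , nt)) = inj₂ (w ++W (c ++W rev wf w) , λ q → nt (conjugate-ε (gain w) (gain c) (lem q)))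
      where
      lem : gain (w ++W (c ++W rev wf w)) ≡ e → (gain w · gain c) · inv (gain w) ≡ e
      lem q = trans (trans (assoc (gain w) (gain c) (inv (gain w)))
        (cong (gain w ·_) (trans (cong (gain c ·_) (sym (gain-rev wf w))) (sym (gain-++ c (rev wf w))))))
        (trans (sym (gain-++ w (c ++W rev wf w))) q)

    balanced-gain-unique : ∀ {x y} → ¬ Unbalanced S x → (w w' : Walk S x y) → gain w ≡ gain w'
    balanced-gain-unique nb w w' with gain w ≟ gain w'
    ... | yes q = q
    ... | no nq = ⊥-elim (nb (inj₂ (w ++W rev wf w' , λ q → nq (x∙y⁻¹≈ε⇒x≈y (gain w) (gain w')
          (trans (cong (gain w ·_) (sym (gain-rev wf w'))) (trans (sym (gain-++ w (rev wf w'))) q))))))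

  unbalanced-mono : ∀ {S T : ESet G nv} → S ⊆ T → ∀ {x} → Unbalanced S x → Unbalanced T x
  unbalanced-mono sub (inj₁ (z , w , l)) = inj₁ (z , mapWalk sub w , sub _ l)
  unbalanced-mono sub (inj₂ (c , nt)) = inj₂ (mapWalk sub c , λ q → nt (trans (sym (gain-mapWalk sub c)) q))

  module _ {S : ESet G nv} where
    data _∈V_ (z : V) : ∀ {a b} → Walk S a b → Set where
      here : ∀ {a b} {w : Walk S a b} → z ≡ a → z ∈V w
      there : ∀ {a y h p b} {w : Walk S y b} → z ∈V w → z ∈V st {x = a} y h p w

    _∈V?_ : ∀ (z : V) {a b} (w : Walk S a b) → Dec (z ∈V w)
    _∈V?_ z {a} w with z ≟ a
    ... | yes q = yes (here q)
    _∈V?_ z {a} [] | no nq = no λ { (here q) → nq q }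
    _∈V?_ z {a} (st y h p w) | no nq with z ∈V? w
    ... | yes r = yes (there r)
    ... | no nr = no λ { (here q) → nq q ; (there r) → nr r }

    end∈ : ∀ {a b} (w : Walk S a b) → b ∈V w
    end∈ [] = here refl
    end∈ (st y h p w) = there (end∈ w)

    Simple : ∀ {a b} → Walk S a b → Set
    Simple [] = ⊤
    Simple {a} (st y h p w) = (¬ (a ∈V w)) × Simple w

    record Split {a b} (w : Walk S a b) (z : V) : Set where
      field
        w1 : Walk S a z
        w2 : Walk S z b
        geq : gain w ≡ gain w1 · gain w2
        s1 : Simple w1
        s2 : Simple w2
        sub1 : ∀ x → x ∈V w1 → x ∈V w
        sub2 : ∀ x → x ∈V w2 → x ∈V w

    split : ∀ {a b z} (w : Walk S a b) → z ∈V w → Simple w → Split w z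
    split w (here refl) sw = record { w1 = [] ; w2 = w ; geq = sym (identityˡ _) ; s1 = tt ; s2 = sw ;
                                     sub1 = λ { x (here q) → here q } ; sub2 = λ x r → r }
    split {a} (st y h p w) (there r) (na , sw) = record { w1 = st {x = a} y h p (Split.w1 sp) ; w2 = Split.w2 sp ;
               geq = trans (cong (h ·_) (Split.geq sp)) (sym (assoc h _ _)) ;
               s1 = (λ q → na (Split.sub1 sp a q)) , Split.s1 sp ; s2 = Split.s2 sp ;
               sub1 = λ { x (here q) → here q ; x (there q) → there (Split.sub1 sp x q) } ;
               sub2 = λ x q → there (Split.sub2 sp x q) }
      where sp = split w r sw

    UnbalancedCycleAt : V → Set
    UnbalancedCycleAt z = Σ V λ y → Σ Gr λ h → Σ (mem S (inj₁ (z , y , h)) ≡ true) λ _ →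
            Σ (Walk S y z) λ w1 → Simple w1 × (h · gain w1 ≢ e)

    ReachesUnbalancedCycle : V → Set
    ReachesUnbalancedCycle a = Σ V λ z → Walk S a z × UnbalancedCycleAt z

    simplify-or-cycle : ∀ {a b} (w : Walk S a b) → (Σ (Walk S a b) λ w' → Simple w' × gain w' ≡ gain w) ⊎ ReachesUnbalancedCycle a
    simplify-or-cycle [] = inj₁ ([] , tt , refl)
    simplify-or-cycle {a} (st y h p w) with simplify-or-cycle w
    ... | inj₂ (z , wz , c) = inj₂ (z , st y h p wz , c)
    ... | inj₁ (w' , sw' , gw') with a ∈V? w'
    ...   | no na = inj₁ (st y h p w' , (na , sw') , cong (h ·_) gw')
    ...   | yes ina with split w' ina sw'
    ...     | record { w1 = w1 ; w2 = w2 ; geq = geq ; s1 = s1 ; s2 = s2 } with h · gain w1 ≟ e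
    ...       | no nt = inj₂ (a , [] , (y , h , p , w1 , s1 , nt))
    ...       | yes tr = inj₁ (w2 , s2 , sym eqn)
      where
      eqn : h · gain w ≡ gain w2
      eqn = trans (cong (h ·_) (trans (sym gw') geq)) (trans (sym (assoc h (gain w1) (gain w2)))
              (trans (cong (_· gain w2) tr) (identityˡ (gain w2))))

    simplify : ∀ {a b} (w : Walk S a b) → Σ (Walk S a b) λ w' → Simple w'
    simplify [] = [] , tt
    simplify {a} (st y h p w) with simplify w
    ... | (w' , sw') with a ∈V? w'
    ...   | no na = st y h p w' , (na , sw')
    ...   | yes ina = Split.w2 (split w' ina sw') , Split.s2 (split w' ina sw')

    simple-closed-gain : ∀ {a} (w : Walk S a a) → Simple w → gain w ≡ e
    simple-closed-gain [] _ = refl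
    simple-closed-gain (st y h p w) (na , _) = ⊥-elim (na (end∈ w))

    vertexAt : ∀ {a b} (w : Walk S a b) → Fin (suc (len w)) → V
    vertexAt {a} w zero = a
    vertexAt (st y h p w) (suc i) = vertexAt w i

    vertexAt-∈ : ∀ {a b} (w : Walk S a b) i → vertexAt w i ∈V w
    vertexAt-∈ w zero = here refl
    vertexAt-∈ (st y h p w) (suc i) = there (vertexAt-∈ w i)

    vertexAt-injective : ∀ {a b} (w : Walk S a b) → Simple w → ∀ i j → vertexAt w i ≡ vertexAt w j → i ≡ j
    vertexAt-injective w sw zero zero q = refl
    vertexAt-injective (st y h p w) (na , sw) zero (suc j) q = ⊥-elim (na (subst (_∈V w) (sym q) (vertexAt-∈ w j)))
    vertexAt-injective (st y h p w) (na , sw) (suc i) zero q = ⊥-elim (na (subst (_∈V w) q (vertexAt-∈ w i)))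
    vertexAt-injective (st y h p w) (na , sw) (suc i) (suc j) q = cong suc (vertexAt-injective w sw i j q)

    simple-length< : ∀ {a b} (w : Walk S a b) → Simple w → len w < nv
    simple-length< w sw with len w <? nv
    ... | yes q = q
    ... | no nq with Finₚ.pigeonhole (s≤s (ℕₚ.≮⇒≥ nq)) (vertexAt w)
    ... | i , j , i<j , eq = ⊥-elim (ℕₚ.<-irrefl (cong toℕ (vertexAt-injective w sw i j eq)) i<j)

    BoundedWalk : ℕ → V → V → Gr → Set
    BoundedWalk k x y g = Σ (Walk S x y) λ w → len w ≤ k × gain w ≡ g

    boundedWalk? : ∀ k x y g → Dec (BoundedWalk k x y g)
    boundedWalk? zero x y g with x ≟ y | g ≟ e
    ... | yes refl | yes refl = yes ([] , z≤n , refl)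
    ... | no nq | _ = no λ { ([] , _ , _) → nq refl ; (st _ _ _ _ , () , _) }
    ... | yes refl | no ng = no λ { ([] , _ , q) → ng (sym q) ; (st _ _ _ _ , () , _) }
    boundedWalk? (suc k) x y g with (x ≟ y ×-dec g ≟ e)
    ... | yes (refl , refl) = yes ([] , z≤n , refl)
    ... | no n0 with any? (λ z → any? (λ h →
                      (Boolₚ._≟_ (mem S (inj₁ (x , z , h))) true) ×-dec boundedWalk? k z y (inv h · g)))
    ...   | yes (z , h , p , w , l , q) = yes (st z h p w , s≤s l , trans (cong (h ·_) q) (trans (sym (assoc h (inv h) g)) (trans (cong (_· g) (inverseʳ h)) (identityˡ g))))
    ...   | no n1 = no λ { ([] , _ , q) → n0 (refl , sym q) ;
                          (st z h p w , s≤s l , q) → n1 (z , h , p , w , l , trans (sym (identityˡ (gain w))) (trans (cong (_· gain w) (sym (inverseˡ h))) (trans (assoc (inv h) h (gain w)) (cong (inv h ·_) q)))) }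

    walk? : ∀ x y → Dec (Walk S x y)
    walk? x y with any? (λ g → boundedWalk? nv x y g)
    ... | yes (g , w , _) = yes w
    ... | no n = no λ w → n (gain (proj₁ (simplify w)) , proj₁ (simplify w) ,
                              ℕₚ.<⇒≤ (simple-length< (proj₁ (simplify w)) (proj₂ (simplify w))) , refl)

  module _ {S : ESet G nv} (wf : WF S) where
    private B = nv + nv

    unbalanced-of-cycle : ∀ {x z} → Walk S x z → UnbalancedCycleAt {S} z → Unbalanced S x
    unbalanced-of-cycle wz (y , h , p , w1 , _ , nt) = unbalanced-transport wf wz (inj₂ (st y h p w1 , nt))

    -- Two walks of different gain and length at most 2 nv make Unbalanced decidable by bounded search.
    short-unbalanced-witness : ∀ {x} → (Σ (Walk S x x) λ c → gain c ≢ e) →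
      Σ V λ y → Σ Gr λ g1 → Σ Gr λ g2 → (g1 ≢ g2) × BoundedWalk {S} B x y g1 × BoundedWalk {S} B x y g2
    short-unbalanced-witness (c , nt) with simplify-or-cycle c
    ... | inj₁ (c' , sc , gq) = ⊥-elim (nt (trans (sym gq) (simple-closed-gain c' sc)))
    ... | inj₂ (z , wz , (y , h , p , w1 , s1 , nt')) =
      z , gain P , gain (P ++W st y h p w1) , neq ,
      (P , ℕₚ.≤-trans (ℕₚ.<⇒≤ lP) (ℕₚ.m≤m+n nv nv) , refl) ,
      (P ++W st y h p w1 , lenB , refl)
      where
      P = proj₁ (simplify wz)
      lP = simple-length< P (proj₂ (simplify wz))
      l1 = simple-length< w1 s1
      neq : gain P ≢ gain (P ++W st y h p w1)
      neq q = nt' ((∙-cancelˡ (gain P) (h · gain w1) e (trans (sym (gain-++ P (st y h p w1))) (trans (sym q) (sym (identityʳ (gain P)))))))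
      lenB : len (P ++W st y h p w1) ≤ B
      lenB rewrite len-++ P (st y h p w1) = ℕₚ.+-mono-≤ (ℕₚ.<⇒≤ lP) l1

    unbalanced? : ∀ x → Dec (Unbalanced S x)
    unbalanced? x with any? (λ y → walk? x y ×-dec Boolₚ._≟_ (mem S (inj₂ y)) true)
    ... | yes (y , w , l) = yes (inj₁ (y , w , l))
    ... | no nl with any? (λ y → any? (λ g1 → any? (λ g2 →
                        ¬? (g1 ≟ g2) ×-dec boundedWalk? B x y g1 ×-dec boundedWalk? B x y g2)))
    ...   | yes (y , g1 , g2 , ne , (w1 , _ , q1) , (w2 , _ , q2)) =
             yes (inj₂ (w1 ++W rev wf w2 , λ q → ne (trans (sym q1) (trans (x∙y⁻¹≈ε⇒x≈y (gain w1) (gain w2)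
               (trans (cong (gain w1 ·_) (sym (gain-rev wf w2))) (trans (sym (gain-++ w1 (rev wf w2))) q))) q2))))
    ...   | no nc = no λ { (inj₁ (y , w , l)) → nl (y , w , l) ;
                           (inj₂ c) → nc (short-unbalanced-witness c) }

    span? : ∀ ed → Dec (Span S ed)
    span? (inj₂ v) = unbalanced? v
    span? (inj₁ (u , v , h)) with unbalanced? u
    ... | yes ub with walk? u v
    ...   | yes w = yes (inj₂ (inj₁ (w , ub)))
    ...   | no nw with unbalanced? v
    ...     | yes vb = yes (inj₁ (ub , vb))
    ...     | no nvb = no λ { (inj₁ (_ , vb)) → nvb vb ; (inj₂ (inj₁ (w , _))) → nw w ; (inj₂ (inj₂ (w , _))) → nw w }
    span? (inj₁ (u , v , h)) | no nub with walk? u v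
    ... | no nw = no λ { (inj₁ (ub , _)) → nub ub ; (inj₂ (inj₁ (w , _))) → nw w ; (inj₂ (inj₂ (w , _))) → nw w }
    ... | yes w with gain w ≟ h
    ...   | yes q = yes (inj₂ (inj₂ (w , q)))
    ...   | no nq = no λ { (inj₁ (ub , _)) → nub ub ; (inj₂ (inj₁ (_ , ub))) → nub ub ;
                           (inj₂ (inj₂ (w' , q))) → nq (trans (balanced-gain-unique wf nub w w') q) }

module Cycles (G : FinGroup) (nv : ℕ) where
  open GroupLemmas G
  open EdgeSets G nv
  open Walks G nv

  next′ : ∀ {n} → Fin (suc n) → Fin (suc n)
  next′ = next {G} {nv}

  prod′ : ∀ {m} → (Fin m → Gr) → Gr
  prod′ = prod {G} {nv}

  polyEdge′ : ∀ {k} → (Fin (suc k) → V) → (Fin (suc k) → Gr) → Fin (suc k) → E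
  polyEdge′ = polyEdge {G} {nv}

  next-inject : ∀ {n} (j : Fin (suc n)) → next′ (inject₁ j) ≡ suc j
  next-inject {zero} zero = refl
  next-inject {suc n} zero = refl
  next-inject {suc n} (suc j) rewrite next-inject {n} j = refl

  next-last : ∀ n → next′ (fromℕ n) ≡ zero
  next-last zero = refl
  next-last (suc n) rewrite next-last n = refl

  data View : ∀ {n} → Fin (suc n) → Set where
    isInj : ∀ {n} (j : Fin n) → View (inject₁ j)
    isLast : ∀ {n} → View (fromℕ n)

  view : ∀ {n} (i : Fin (suc n)) → View i
  view {zero} zero = isLast
  view {suc n} zero = isInj zero
  view {suc n} (suc i) with view i
  ... | isInj j = isInj (suc j)
  ... | isLast = isLast

  inject≢last : ∀ {n} (j : Fin n) → inject₁ j ≢ fromℕ n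
  inject≢last (suc j) q = inject≢last j (Finₚ.suc-injective q)

  next-injective : ∀ {n} (i i' : Fin (suc n)) → next′ i ≡ next′ i' → i ≡ i'
  next-injective {n} i i' q with view i | view i'
  ... | isLast | isLast = refl
  next-injective {suc n} i i' q | isInj j | isInj j' = cong inject₁ (Finₚ.suc-injective (trans (sym (next-inject j)) (trans q (next-inject j'))))
  next-injective {suc n} i i' q | isInj j | isLast with trans (sym (next-inject j)) (trans q (next-last (suc n)))
  ... | ()
  next-injective {suc n} i i' q | isLast | isInj j' with trans (sym (next-last (suc n))) (trans q (next-inject j'))
  ... | ()
  next-injective {zero} i i' q | isInj () | _
  next-injective {zero} i i' q | isLast | isInj ()

  prod-ext : ∀ {n} {F H : Fin n → Gr} → (∀ i → F i ≡ H i) → prod′ F ≡ prod′ H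
  prod-ext {zero} h = refl
  prod-ext {suc n} h = cong₂ _·_ (h zero) (prod-ext (λ i → h (suc i)))

  prod-snoc : ∀ {n} (F : Fin (suc n) → Gr) → prod′ F ≡ prod′ (λ j → F (inject₁ j)) · F (fromℕ n)
  prod-snoc {zero} F = trans (identityʳ (F zero)) (sym (identityˡ (F zero)))
  prod-snoc {suc n} F = trans (cong (F zero ·_) (prod-snoc (λ i → F (suc i)))) (sym (assoc (F zero) _ _))

  prod-rotate : ∀ {k} (F : Fin (suc (suc k)) → Gr) → prod′ (λ i → F (next′ i)) ≡ prod′ (λ i → F (suc i)) · F zero
  prod-rotate {k} F = trans (prod-snoc (λ i → F (next′ i)))
    (cong₂ _·_ (prod-ext (λ j → cong F (next-inject j))) (cong F (next-last (suc k))))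

  prod-rotate-ε⁻ : ∀ {k} (F : Fin (suc (suc k)) → Gr) → prod′ (λ i → F (next′ i)) ≡ e → prod′ F ≡ e
  prod-rotate-ε⁻ F q = rotate-ε _ _ (trans (sym (prod-rotate F)) q)

  prod-rotate-ε : ∀ {k} (F : Fin (suc (suc k)) → Gr) → prod′ F ≡ e → prod′ (λ i → F (next′ i)) ≡ e
  prod-rotate-ε F q = trans (prod-rotate F) (rotate-ε _ _ q)

  module _ {T : ESet G nv} where
    AllSteps : (E → Set) → ∀ {a b} → Walk T a b → Set
    AllSteps P [] = ⊤
    AllSteps P {a} (st y h p w) = P (inj₁ (a , y , h)) × AllSteps P w

    AllSteps-map : ∀ {P Q : E → Set} → (∀ f → P f → Q f) → ∀ {a b} (w : Walk T a b) → AllSteps P w → AllSteps Q w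
    AllSteps-map h [] _ = tt
    AllSteps-map h (st y g p w) (x , r) = h _ x , AllSteps-map h w r

    AllSteps-++ : ∀ {P : E → Set} {a b c} (w : Walk T a b) (v : Walk T b c) → AllSteps P w → AllSteps P v → AllSteps P (w ++W v)
    AllSteps-++ [] v _ r = r
    AllSteps-++ (st y g p w) v (x , q) r = x , AllSteps-++ w v q r

    AllSteps-mem : ∀ {a b} (w : Walk T a b) → AllSteps (λ f → mem T f ≡ true) w
    AllSteps-mem [] = tt
    AllSteps-mem (st y g p w) = p , AllSteps-mem w

    prefix : ∀ {a b z} (w : Walk T a b) → z ∈V w → Walk T a z
    prefix w (here refl) = []
    prefix (st y h p w) (there r) = st y h p (prefix w r)

    pathWalk : ∀ {n} (F : Fin (suc n) → V) (H : Fin n → Gr) → (∀ j → mem T (inj₁ (F (inject₁ j) , F (suc j) , H j)) ≡ true)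
          → Walk T (F zero) (F (fromℕ n))
    pathWalk {zero} F H ms = []
    pathWalk {suc n} F H ms = st (F (suc zero)) (H zero) (ms zero) (pathWalk (λ i → F (suc i)) (λ j → H (suc j)) (λ j → ms (suc j)))

    pathWalk-gain : ∀ {n} F H ms → gain (pathWalk {n} F H ms) ≡ prod′ H
    pathWalk-gain {zero} F H ms = refl
    pathWalk-gain {suc n} F H ms = cong (H zero ·_) (pathWalk-gain (λ i → F (suc i)) (λ j → H (suc j)) (λ j → ms (suc j)))

    pathWalk-steps : ∀ {n} (P : E → Set) F H ms → (∀ j → P (inj₁ (F (inject₁ j) , F (suc j) , H j))) → AllSteps P (pathWalk {n} F H ms)
    pathWalk-steps {zero} P F H ms h = tt
    pathWalk-steps {suc n} P F H ms h = h zero , pathWalk-steps P (λ i → F (suc i)) (λ j → H (suc j)) (λ j → ms (suc j)) (λ j → h (suc j))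

    pathWalk-∈ : ∀ {n} F H ms (j : Fin (suc n)) → F j ∈V pathWalk {n} F H ms
    pathWalk-∈ {zero} F H ms zero = here refl
    pathWalk-∈ {suc n} F H ms zero = here refl
    pathWalk-∈ {suc n} F H ms (suc j) = there (pathWalk-∈ (λ i → F (suc i)) (λ j → H (suc j)) (λ j → ms (suc j)) j)

    record Polygon (k : ℕ) : Set where
      constructor polygon
      field
        vs : Fin (suc (suc k)) → V
        gs : Fin (suc (suc k)) → Gr
        ms : ∀ i → mem T (polyEdge′ vs gs i) ≡ true

    polyEdge′-inject : ∀ {k} (vs : Fin (suc (suc k)) → V) gs (j : Fin (suc k)) → polyEdge′ vs gs (inject₁ j) ≡ inj₁ (vs (inject₁ j) , vs (suc j) , gs (inject₁ j))
    polyEdge′-inject vs gs j = cong (λ z → inj₁ (vs (inject₁ j) , vs z , gs (inject₁ j))) (next-inject j)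

    polyEdge′-last : ∀ {k} (vs : Fin (suc (suc k)) → V) gs → polyEdge′ vs gs (fromℕ (suc k)) ≡ inj₁ (vs (fromℕ (suc k)) , vs zero , gs (fromℕ (suc k)))
    polyEdge′-last {k} vs gs = cong (λ z → inj₁ (vs (fromℕ (suc k)) , vs z , gs (fromℕ (suc k)))) (next-last (suc k))

    -- The rest of the polygon after removing edge i; built for the last edge and transported by rotation.
    Arc : ∀ {k} → Polygon k → Fin (suc (suc k)) → Set
    Arc (polygon vs gs ms) i = Σ (Walk T (vs (next′ i)) (vs i)) λ R →
      AllSteps (λ f → Σ (Fin _) λ j → (j ≢ i) × sameEdge f (polyEdge′ vs gs j) ≡ true) R ×
      ((gs i · gain R ≡ e → prod′ gs ≡ e) × (prod′ gs ≡ e → gs i · gain R ≡ e))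

    arc-last : ∀ {k} (d : Polygon k) → Arc d (fromℕ (suc k))
    arc-last {k} (polygon vs gs ms) = R' , proj₂ (transport (sym (next-last (suc k))) R) stepsR , bal1 , bal2
      where
      Other : E → Set
      Other f = Σ (Fin _) λ j → (j ≢ fromℕ (suc k)) × sameEdge f (polyEdge′ vs gs j) ≡ true
      ms' : ∀ j → mem T (inj₁ (vs (inject₁ j) , vs (suc j) , gs (inject₁ j))) ≡ true
      ms' j = subst (λ z → mem T z ≡ true) (polyEdge′-inject vs gs j) (ms (inject₁ j))
      R : Walk T (vs zero) (vs (fromℕ (suc k)))
      R = pathWalk vs (λ j → gs (inject₁ j)) ms'
      R' : Walk T (vs (next′ (fromℕ (suc k)))) (vs (fromℕ (suc k)))
      R' = subst (λ z → Walk T (vs z) (vs (fromℕ (suc k)))) (sym (next-last (suc k))) R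
      transport : ∀ {a a'} (q : a ≡ a') (W : Walk T (vs a) (vs (fromℕ (suc k)))) →
                  gain (subst (λ z → Walk T (vs z) (vs (fromℕ (suc k)))) q W) ≡ gain W ×
                  (AllSteps Other W → AllSteps Other (subst (λ z → Walk T (vs z) (vs (fromℕ (suc k)))) q W))
      transport refl W = refl , λ x → x
      gR : gain R' ≡ prod′ (λ j → gs (inject₁ j))
      gR = trans (proj₁ (transport (sym (next-last (suc k))) R)) (pathWalk-gain vs (λ j → gs (inject₁ j)) ms')
      stepsR : AllSteps Other R
      stepsR = pathWalk-steps _ vs (λ j → gs (inject₁ j)) ms'
        (λ j → inject₁ j , inject≢last j ,
           subst (λ z → sameEdge (inj₁ (vs (inject₁ j) , vs (suc j) , gs (inject₁ j))) z ≡ true) (sym (polyEdge′-inject vs gs j)) (sameEdge-refl (inj₁ (vs (inject₁ j) , vs (suc j) , gs (inject₁ j)))))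
      bal1 : gs (fromℕ (suc k)) · gain R' ≡ e → prod′ gs ≡ e
      bal1 q = trans (prod-snoc gs) (trans (cong (_· gs (fromℕ (suc k))) (sym gR)) (rotate-ε _ _ q))
      bal2 : prod′ gs ≡ e → gs (fromℕ (suc k)) · gain R' ≡ e
      bal2 q = rotate-ε _ _ (trans (cong (_· gs (fromℕ (suc k))) gR) (trans (sym (prod-snoc gs)) q))

    rotate : ∀ {k} → Polygon k → Polygon k
    rotate (polygon vs gs ms) = polygon (λ i → vs (next′ i)) (λ i → gs (next′ i)) (λ i → ms (next′ i))

    arc-rotate : ∀ {k} (d : Polygon k) (j : Fin (suc (suc k))) → Arc (rotate d) j → Arc d (next′ j)
    arc-rotate (polygon vs gs ms) j (R , steps , b1 , b2) =
      R , AllSteps-map (λ f → λ { (j' , ne , q) → next′ j' , (λ r → ne (next-injective j' j r)) , q }) R steps ,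
      (λ q → prod-rotate-ε⁻ gs (b1 q)) , (λ q → b2 (prod-rotate-ε gs q))

    iterateNext : ∀ {k} → ℕ → Fin (suc (suc k))
    iterateNext {k} zero = fromℕ (suc k)
    iterateNext (suc t) = next′ (iterateNext t)

    arc-iterate : ∀ {k} t (d : Polygon k) → Arc d (iterateNext t)
    arc-iterate zero d = arc-last d
    arc-iterate (suc t) d = arc-rotate d (iterateNext t) (arc-iterate t (rotate d))

    iterateNext-reaches : ∀ {k} n (i : Fin (suc (suc k))) → toℕ i ≡ n → Σ ℕ λ t → iterateNext {k} t ≡ i
    iterateNext-reaches {k} zero zero _ = 1 , next-last (suc k)
    iterateNext-reaches {k} (suc n) (suc j) q with iterateNext-reaches n (inject₁ j) (trans (Finₚ.toℕ-inject₁ j) (ℕₚ.suc-injective q))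
    ... | t , r = suc t , trans (cong next′ r) (next-inject j)

    arc : ∀ {k} (d : Polygon k) i → Arc d i
    arc d i with iterateNext-reaches (toℕ i) i refl
    ... | t , refl = arc-iterate t d

    arcFromStart : ∀ {k} (d : Polygon k) j → Walk T (Polygon.vs d zero) (Polygon.vs d j)
    arcFromStart (polygon vs gs ms) j = prefix R (pathWalk-∈ vs (λ j → gs (inject₁ j)) ms' j)
      where
      ms' : ∀ j → mem T (inj₁ (vs (inject₁ j) , vs (suc j) , gs (inject₁ j))) ≡ true
      ms' j = subst (λ z → mem T z ≡ true) (polyEdge′-inject vs gs j) (ms (inject₁ j))
      R = pathWalk vs (λ j → gs (inject₁ j)) ms'

  module CycleWalks {T : ESet G nv} (wf : WF T) where
    cycle-unbalanced : ∀ (C : Cycle T) → ¬ Balanced C → ∀ x → OnCycle C x → Unbalanced T x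
    cycle-unbalanced (loopC v p) nb x refl = inj₁ (v , [] , p)
    cycle-unbalanced (polyC k vs inj gs ms dist) nb x (i , refl) with arc (polygon vs gs ms) i
    ... | (R , _ , b1 , _) = inj₂ (st (vs (next′ i)) (gs i) (ms i) R , λ q → nb (b1 q))

    cycle-connected : ∀ (C : Cycle T) x y → OnCycle C x → OnCycle C y → Walk T x y
    cycle-connected (loopC v p) x y refl refl = []
    cycle-connected (polyC k vs inj gs ms dist) x y (i , refl) (j , refl) =
      rev wf (arcFromStart (polygon vs gs ms) i) ++W arcFromStart (polygon vs gs ms) j

  mapCycle : ∀ {S T : ESet G nv} → S ⊆ T → Cycle S → Cycle T
  mapCycle sub (loopC v p) = loopC v (sub _ p)
  mapCycle sub (polyC k vs inj gs ms dist) = polyC k vs inj gs (λ i → sub _ (ms i)) dist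

  restrictCycle : ∀ {S T : ESet G nv} (C : Cycle T) → (∀ f → InCycle C f → mem S f ≡ true) → Cycle S
  restrictCycle (loopC v p) h = loopC v (h _ (sameEdge-refl (inj₂ v)))
  restrictCycle (polyC k vs inj gs ms dist) h = polyC k vs inj gs (λ i → h _ (i , sameEdge-refl (polyEdge′ vs gs i))) dist

  module _ {S T : ESet G nv} where
    mapCycle-balanced⁻ : (sub : S ⊆ T) (C : Cycle S) → Balanced (mapCycle sub C) → Balanced C
    mapCycle-balanced⁻ sub (loopC v p) b = b
    mapCycle-balanced⁻ sub (polyC k vs inj gs ms dist) b = b

    mapCycle-balanced : (sub : S ⊆ T) (C : Cycle S) → Balanced C → Balanced (mapCycle sub C)
    mapCycle-balanced sub (loopC v p) b = b
    mapCycle-balanced sub (polyC k vs inj gs ms dist) b = b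

    mapCycle-in⁻ : (sub : S ⊆ T) (C : Cycle S) (f : E) → InCycle (mapCycle sub C) f → InCycle C f
    mapCycle-in⁻ sub (loopC v p) f x = x
    mapCycle-in⁻ sub (polyC k vs inj gs ms dist) f x = x

    mapCycle-in : (sub : S ⊆ T) (C : Cycle S) (f : E) → InCycle C f → InCycle (mapCycle sub C) f
    mapCycle-in sub (loopC v p) f x = x
    mapCycle-in sub (polyC k vs inj gs ms dist) f x = x

    mapCycle-on : (sub : S ⊆ T) (C : Cycle S) (x : V) → OnCycle C x → OnCycle (mapCycle sub C) x
    mapCycle-on sub (loopC v p) x q = q
    mapCycle-on sub (polyC k vs inj gs ms dist) x q = q

    restrictCycle-balanced⁻ : (C : Cycle T) (h : ∀ f → InCycle C f → mem S f ≡ true) → Balanced (restrictCycle {S} C h) → Balanced C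
    restrictCycle-balanced⁻ (loopC v p) h b = b
    restrictCycle-balanced⁻ (polyC k vs inj gs ms dist) h b = b

    restrictCycle-balanced : (C : Cycle T) (h : ∀ f → InCycle C f → mem S f ≡ true) → Balanced C → Balanced (restrictCycle {S} C h)
    restrictCycle-balanced (loopC v p) h b = b
    restrictCycle-balanced (polyC k vs inj gs ms dist) h b = b

    restrictCycle-in⁻ : (C : Cycle T) (h : ∀ f → InCycle C f → mem S f ≡ true) (f : E) → InCycle (restrictCycle {S} C h) f → InCycle C f
    restrictCycle-in⁻ (loopC v p) h f x = x
    restrictCycle-in⁻ (polyC k vs inj gs ms dist) h f x = x

    restrictCycle-in : (C : Cycle T) (h : ∀ f → InCycle C f → mem S f ≡ true) (f : E) → InCycle C f → InCycle (restrictCycle {S} C h) f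
    restrictCycle-in (loopC v p) h f x = x
    restrictCycle-in (polyC k vs inj gs ms dist) h f x = x

    restrictCycle-on : (C : Cycle T) (h : ∀ f → InCycle C f → mem S f ≡ true) (x : V) → OnCycle C x → OnCycle (restrictCycle {S} C h) x
    restrictCycle-on (loopC v p) h x q = q
    restrictCycle-on (polyC k vs inj gs ms dist) h x q = q

  conn-map : ∀ {S T : ESet G nv} → S ⊆ T → ∀ {x y} → Connected S x y → Connected T x y
  conn-map sub sε = sε
  conn-map sub ((h , p) ◅ s) = (h , sub _ p) ◅ conn-map sub s

  independent-⊆ : ∀ {I J : ESet G nv} → J ⊆ I → Independent I → Independent J
  independent-⊆ {I} {J} sub (ind1 , ind2) =
    (λ C b → ind1 (mapCycle sub C) (mapCycle-balanced sub C b)) ,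
    (λ C D nbC nbD (x , y , oC , oD , c) →
      let se = ind2 (mapCycle sub C) (mapCycle sub D) (λ b → nbC (mapCycle-balanced⁻ sub C b)) (λ b → nbD (mapCycle-balanced⁻ sub D b))
                 (x , y , mapCycle-on sub C x oC , mapCycle-on sub D y oD , conn-map sub c)
      in λ f → (λ i → mapCycle-in⁻ sub D f (proj₁ (se f) (mapCycle-in sub C f i))) ,
               (λ i → mapCycle-in⁻ sub C f (proj₂ (se f) (mapCycle-in sub D f i))))

  module _ {T : ESet G nv} where
    gainsAround : ∀ {a b} (w : Walk T a b) → Gr → Fin (suc (len w)) → Gr
    gainsAround [] h zero = h
    gainsAround (st y g p w) h zero = g
    gainsAround (st y g p w) h (suc i) = gainsAround w h i

    vertexAt-last : ∀ {a b} (w : Walk T a b) → vertexAt w (fromℕ (len w)) ≡ b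
    vertexAt-last [] = refl
    vertexAt-last (st y g p w) = vertexAt-last w

    gainsAround-last : ∀ {a b} (w : Walk T a b) h → gainsAround w h (fromℕ (len w)) ≡ h
    gainsAround-last [] h = refl
    gainsAround-last (st y g p w) h = gainsAround-last w h

    step-along : ∀ {P : E → Set} {a b} (w : Walk T a b) h → AllSteps P w → ∀ j → P (inj₁ (vertexAt w (inject₁ j) , vertexAt w (suc j) , gainsAround w h (inject₁ j)))
    step-along (st y g p w) h (x , r) zero = x
    step-along (st y g p w) h (x , r) (suc j) = step-along w h r j

    prod-gainsAround : ∀ {a b} (w : Walk T a b) h → prod′ (gainsAround w h) ≡ gain w · h
    prod-gainsAround [] h = trans (identityʳ h) (sym (identityˡ h))
    prod-gainsAround (st y g p w) h = trans (cong (g ·_) (prod-gainsAround w h)) (sym (assoc g (gain w) h))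

    module CloseUp (x y : V) (h : Gr) (cl : mem T (inj₁ (x , y , h)) ≡ true) {y' : V} (g : Gr)
                   (p : mem T (inj₁ (y , y' , g)) ≡ true) (w' : Walk T y' x) (sw : Simple (st y' g p w'))
                   (al : AllSteps (λ f → sameEdge (inj₁ (x , y , h)) f ≡ false) (st y' g p w')) where
      w : Walk T y x
      w = st y' g p w'
      k = len w'
      vs = vertexAt w
      gs = gainsAround w h

      closingEdge : polyEdge′ vs gs (fromℕ (suc k)) ≡ inj₁ (x , y , h)
      closingEdge = trans (polyEdge′-last {T = T} vs gs) (cong₂ (λ a b → inj₁ (a , y , b)) (vertexAt-last w) (gainsAround-last w h))

      ms : ∀ i → mem T (polyEdge′ vs gs i) ≡ true
      ms i with view i
      ... | isInj j = subst (λ z → mem T z ≡ true) (sym (polyEdge′-inject {T = T} vs gs j)) (step-along w h (AllSteps-mem w) j)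
      ... | isLast = subst (λ z → mem T z ≡ true) (sym closingEdge) cl

      no-repeated-edge : ∀ i j → i ≢ j → sameEdge (polyEdge′ vs gs i) (polyEdge′ vs gs j) ≡ true → ⊥
      no-repeated-edge i j ne q with view i | view j
      ... | isInj a | isInj b with sameEdge-ends _ _ _ _ _ _ (subst₂ (λ X Y → sameEdge X Y ≡ true) (polyEdge′-inject {T = T} vs gs a) (polyEdge′-inject {T = T} vs gs b) q)
      ...   | inj₁ (q1 , _ , _) = ne (vertexAt-injective w sw _ _ q1)
      ...   | inj₂ (q1 , q2 , _) = absurd (cong toℕ (vertexAt-injective w sw _ _ q1)) (cong toℕ (vertexAt-injective w sw _ _ q2))
        where
        n≢2+n : ∀ n → n ≢ suc (suc n)
        n≢2+n zero ()
        n≢2+n (suc n) r = n≢2+n n (ℕₚ.suc-injective r)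
        absurd : toℕ (inject₁ a) ≡ toℕ (suc b) → toℕ (suc a) ≡ toℕ (inject₁ b) → ⊥
        absurd r1 r2 rewrite Finₚ.toℕ-inject₁ a | Finₚ.toℕ-inject₁ b =
          n≢2+n (toℕ b) (trans (sym r2) (cong suc r1))
      no-repeated-edge i j ne q | isInj a | isLast =
        true≢false (trans (sym (sameEdge-sym (inj₁ (vs (inject₁ a) , vs (suc a) , gs (inject₁ a))) (inj₁ (x , y , h)) (subst₂ (λ X Y → sameEdge X Y ≡ true) (polyEdge′-inject {T = T} vs gs a) closingEdge q))) (step-along w h al a))
      no-repeated-edge i j ne q | isLast | isInj b =
        true≢false (trans (sym (subst₂ (λ X Y → sameEdge X Y ≡ true) closingEdge (polyEdge′-inject {T = T} vs gs b) q)) (step-along w h al b))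
      no-repeated-edge i j ne q | isLast | isLast = ne refl

      dist : ∀ i j → i ≢ j → sameEdge (polyEdge′ vs gs i) (polyEdge′ vs gs j) ≡ false
      dist i j ne = not-true (no-repeated-edge i j ne)

      cycle : Cycle T
      cycle = polyC k vs (λ {i} {j} → vertexAt-injective w sw i j) gs ms dist

      cycle-balanced⁻ : Balanced cycle → gain w · h ≡ e
      cycle-balanced⁻ b = trans (sym (prod-gainsAround w h)) b

      cycle-balanced : gain w · h ≡ e → Balanced cycle
      cycle-balanced q = trans (prod-gainsAround w h) q

      cycle-∋-closing : InCycle cycle (inj₁ (x , y , h))
      cycle-∋-closing = fromℕ (suc k) , subst (λ z → sameEdge (inj₁ (x , y , h)) z ≡ true) (sym closingEdge) (sameEdge-refl (inj₁ (x , y , h)))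

      cycle-on-start : OnCycle cycle y
      cycle-on-start = zero , refl

module Independence (G : FinGroup) (nv : ℕ) where
  open GroupLemmas G
  open EdgeSets G nv
  open Walks G nv
  open Cycles G nv

  walkIn : ∀ {S T : ESet G nv} {a b} (R : Walk T a b) → AllSteps (λ f → mem S f ≡ true) R → Walk S a b
  walkIn [] _ = []
  walkIn (st y h p R) (q , r) = st y h q (walkIn R r)

  gain-walkIn : ∀ {S T : ESet G nv} {a b} (R : Walk T a b) al → gain (walkIn {S} R al) ≡ gain R
  gain-walkIn [] _ = refl
  gain-walkIn (st y h p R) (q , r) = cong (h ·_) (gain-walkIn R r)

  source : E → V
  source (inj₁ (a , b , g)) = a
  source (inj₂ w) = w

  module EdgeInsertion (I : ESet G nv) (u v : V) (h : Gr) where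
    mem-insert : ∀ f → mem (insert I (inj₁ (u , v , h))) f ≡ true → mem I f ≡ true ⊎ sameEdge f (inj₁ (u , v , h)) ≡ true
    mem-insert f q = ∨-true q

    steps-old-or-new : ∀ {a b} (W : Walk (insert I (inj₁ (u , v , h))) a b) →
                       AllSteps (λ f → mem I f ≡ true ⊎ sameEdge f (inj₁ (u , v , h)) ≡ true) W
    steps-old-or-new W = AllSteps-map mem-insert W (AllSteps-mem W)

    reroute : ∀ {S : ESet G nv} → WF S → Walk S u v → ∀ {T : ESet G nv} {a b} (W : Walk T a b) →
              AllSteps (λ f → mem S f ≡ true ⊎ sameEdge f (inj₁ (u , v , h)) ≡ true) W → Walk S a b
    reroute wfS R [] _ = []
    reroute wfS R (st y g p W) (inj₁ m , r) = st y g m (reroute wfS R W r)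
    reroute wfS R {a = a} (st y g p W) (inj₂ s , r) with sameEdge-ends a y g u v h s
    ... | inj₁ (refl , refl , _) = R ++W reroute wfS R W r
    ... | inj₂ (refl , refl , _) = rev wfS R ++W reroute wfS R W r

    decompose : ∀ {x y} → Walk (insert I (inj₁ (u , v , h))) x y →
                Walk I x y ⊎ (Walk I x u × Walk I v y) ⊎ (Walk I x v × Walk I u y)
    decompose [] = inj₁ []
    decompose {x} (st y1 g p W) with mem-insert _ p | decompose W
    ... | inj₁ m | inj₁ W1 = inj₁ (st y1 g m W1)
    ... | inj₁ m | inj₂ (inj₁ (W1 , W2)) = inj₂ (inj₁ (st y1 g m W1 , W2))
    ... | inj₁ m | inj₂ (inj₂ (W1 , W2)) = inj₂ (inj₂ (st y1 g m W1 , W2))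
    ... | inj₂ s | r with sameEdge-ends x y1 g u v h s
    ...   | inj₁ (refl , refl , _) = [ (λ W1 → inj₂ (inj₁ ([] , W1))) , [ (λ { (_ , W2) → inj₂ (inj₁ ([] , W2)) }) , (λ { (_ , W2) → inj₁ W2 }) ] ] r
    ...   | inj₂ (refl , refl , _) = [ (λ W1 → inj₂ (inj₂ ([] , W1))) , [ (λ { (_ , W2) → inj₁ W2 }) , (λ { (_ , W2) → inj₂ (inj₂ ([] , W2)) }) ] ] r

  module _ {S : ESet G nv} where
    inCycle-mem : WF S → (C : Cycle S) → ∀ f → InCycle C f → mem S f ≡ true
    inCycle-mem wf (loopC v p) f q = trans (proj₁ wf _ _ q) p
    inCycle-mem wf (polyC k vs inj gs ms dist) f (i , q) = trans (proj₁ wf _ _ q) (ms i)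

    inCycle-on : (C : Cycle S) → ∀ f → InCycle C f → OnCycle C (source f)
    inCycle-on (loopC v p) (inj₂ w) q = ⌊≟⌋-sound w v q
    inCycle-on (loopC v p) (inj₁ x) ()
    inCycle-on (polyC k vs inj gs ms dist) (inj₁ (a , b , g)) (i , q) with sameEdge-ends a b g (vs i) (vs (next′ i)) (gs i) q
    ... | inj₁ (q1 , _ , _) = i , sym q1
    ... | inj₂ (q1 , _ , _) = next′ i , sym q1
    inCycle-on (polyC k vs inj gs ms dist) (inj₂ w) (i , ())

    inCycle? : (C : Cycle S) → ∀ f → Dec (InCycle C f)
    inCycle? (loopC v p) f = Boolₚ._≟_ (sameEdge f (inj₂ v)) true
    inCycle? (polyC k vs inj gs ms dist) f = any? (λ i → Boolₚ._≟_ (sameEdge f (polyEdge′ vs gs i)) true)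

    inCycle-resp : (C : Cycle S) → ∀ f f' → sameEdge f f' ≡ true → InCycle C f → InCycle C f'
    inCycle-resp (loopC v p) f f' s q = sameEdge-trans f' f (inj₂ v) (sameEdge-sym f f' s) q
    inCycle-resp (polyC k vs inj gs ms dist) f f' s (i , q) = i , sameEdge-trans f' f _ (sameEdge-sym f f' s) q

  next′≢ : ∀ {k} (j : Fin (suc (suc k))) → next′ j ≢ j
  next′≢ {k} j q with view j
  ... | isInj a = ℕₚ.1+n≢n (trans (sym (cong toℕ (next-inject a))) (trans (cong toℕ q) (Finₚ.toℕ-inject₁ a)))
  ... | isLast with trans (sym (next-last (suc k))) q
  ... | ()

  module _ {S : ESet G nv} where
    Ends : ∀ {a b} → Walk S a b → E → Set
    Ends w (inj₁ (c , d , t)) = c ∈V w × d ∈V w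
    Ends w (inj₂ _) = ⊥

    step-ends : ∀ {a b} (w : Walk S a b) → AllSteps (Ends w) w
    step-ends [] = tt
    step-ends (st y h p w) = (here refl , there (here refl)) ,
      AllSteps-map (λ { (inj₁ (c , d , t)) (x1 , x2) → there x1 , there x2 ; (inj₂ _) () }) w (step-ends w)

    closing-edge-distinct : ∀ {y' z} h g (w : Walk S y' z) → Simple w → z ≡ y' → h ≡ inv g → h · (g · gain w) ≢ e → ⊥
    closing-edge-distinct h g [] _ _ q3 nt = nt (trans (cong (λ t → t · (g · e)) q3) (trans (cong (inv g ·_) (identityʳ g)) (inverseˡ g)))
    closing-edge-distinct h g (st y'' g' p' w'') (ny , _) q1 _ _ = ny (subst (_∈V w'') q1 (end∈ w''))

    closing-edge-fresh : ∀ {y z} h (w : Walk S y z) → Simple w → h · gain w ≢ e →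
                   AllSteps (λ f → sameEdge (inj₁ (z , y , h)) f ≡ false) w
    closing-edge-fresh {y} {z} h [] _ nt = tt
    closing-edge-fresh {y} {z} h (st y' g p w) (ny , sw) nt = first , AllSteps-map rest w (step-ends w)
      where
      first : sameEdge (inj₁ (z , y , h)) (inj₁ (y , y' , g)) ≡ false
      first = not-true λ q → [ (λ { (q1 , q2 , q3) → ny (subst (_∈V w) q1 (end∈ w)) }) ,
                                       (λ { (q1 , q2 , q3) → lem q1 q3 }) ] (sameEdge-ends z y h y y' g q)
        where
        lem : z ≡ y' → h ≡ inv g → ⊥
        lem q1 q3 = closing-edge-distinct h g w sw q1 q3 nt
      rest : ∀ f → Ends w f → sameEdge (inj₁ (z , y , h)) f ≡ false
      rest (inj₁ (c , d , t)) (c∈ , d∈) = not-true λ q → [ (λ { (q1 , q2 , q3) → ny (subst (_∈V w) (sym q2) d∈) }) ,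
                                       (λ { (q1 , q2 , q3) → ny (subst (_∈V w) (sym q2) c∈) }) ] (sameEdge-ends z y h c d t q)

  module _ {S : ESet G nv} (wf : WF S) where
    unbalanced⇒cycle : ∀ {x} → Unbalanced S x → Σ (Cycle S) λ C → (¬ Balanced C) × Σ V λ y → OnCycle C y × Walk S x y
    unbalanced⇒cycle (inj₁ (y , w , l)) = loopC y l , (λ ()) , y , refl , w
    unbalanced⇒cycle (inj₂ (c , nt)) with simplify-or-cycle c
    ... | inj₁ (c' , sc , gq) = ⊥-elim (nt (trans (sym gq) (simple-closed-gain c' sc)))
    ... | inj₂ (z , wz , (y' , h' , p' , [] , s1 , nt')) = ⊥-elim (true≢false (trans (sym p') (proj₂ wf z h')))
    ... | inj₂ (z , wz , (y' , h' , p' , st y'' g p w1 , s1 , nt')) =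
          C.cycle , (λ b → nt' (rotate-ε _ _ (C.cycle-balanced⁻ b))) , y' , C.cycle-on-start , wz ++W st y' h' p' []
      where
      module C = CloseUp z y' h' p' g p w1 s1 (closing-edge-fresh h' (st y'' g p w1) s1 nt')

  module _ {S T : ESet G nv} (sub : S ⊆ T) where
    ∈V-map : ∀ {a b z} (w : Walk S a b) → z ∈V mapWalk sub w → z ∈V w
    ∈V-map [] (here q) = here q
    ∈V-map (st y h p w) (here q) = here q
    ∈V-map (st y h p w) (there r) = there (∈V-map w r)

    simple-map : ∀ {a b} (w : Walk S a b) → Simple w → Simple (mapWalk sub w)
    simple-map [] _ = tt
    simple-map (st y h p w) (na , sw) = (λ r → na (∈V-map w r)) , simple-map w sw

    AllSteps-mapWalk : ∀ {P : E → Set} {a b} (w : Walk S a b) → AllSteps P w → AllSteps P (mapWalk sub w)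
    AllSteps-mapWalk [] _ = tt
    AllSteps-mapWalk (st y h p w) (x , r) = x , AllSteps-mapWalk w r

  balanced? : ∀ {S : ESet G nv} (C : Cycle S) → Dec (Balanced C)
  balanced? (loopC v p) = no (λ ())
  balanced? (polyC k vs inj gs ms dist) = prod′ gs ≟ e

  someEdgeOf : ∀ {S : ESet G nv} (C : Cycle S) → Σ E (InCycle C)
  someEdgeOf (loopC v p) = inj₂ v , sameEdge-refl (inj₂ v)
  someEdgeOf (polyC k vs inj gs ms dist) = polyEdge′ vs gs zero , zero , sameEdge-refl (polyEdge′ vs gs zero)

  module InsertIndependent {I : ESet G nv} (wfI : WF I) (ed : E) (nd : NonDegenerate ed) (notin : mem I ed ≡ false) where
    T = insert I ed
    wfT = WF-insert wfI ed nd
    subIT : I ⊆ T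
    subIT = insert-⊆ ed

    noEd : (D : Cycle I) → ¬ InCycle D ed
    noEd D q = true≢false (trans (sym (inCycle-mem wfI D ed q)) notin)

    clash : Independent T → (C : Cycle T) → InCycle C ed → ¬ Balanced C → (D : Cycle I) → ¬ Balanced D →
            ∀ x y → OnCycle C x → OnCycle D y → Walk T x y → ⊥
    clash indT C inC nbC D nbD x y oC oD w =
      noEd D (mapCycle-in⁻ subIT D ed (proj₁ (proj₂ indT C (mapCycle subIT D) nbC (λ b → nbD (mapCycle-balanced⁻ subIT D b))
        (x , y , oC , mapCycle-on subIT D y oD , walk→star w) ed) inC))

    module EdgeCase (u v : V) (h : Gr) (eq : ed ≡ inj₁ (u , v , h)) where
      cl~ed : sameEdge (inj₁ (v , u , inv h)) ed ≡ true
      cl~ed = subst (λ z → sameEdge (inj₁ (v , u , inv h)) z ≡ true) (sym eq) (sameEdge-sym (inj₁ (u , v , h)) (inj₁ (v , u , inv h)) (sameEdge-flip u v h))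

      cl : mem T (inj₁ (v , u , inv h)) ≡ true
      cl = ∨-introʳ (mem I (inj₁ (v , u , inv h))) cl~ed

      alP : ∀ {a b} (P : Walk I a b) → AllSteps (λ f → sameEdge (inj₁ (v , u , inv h)) f ≡ false) (mapWalk subIT P)
      alP P = AllSteps-mapWalk subIT P (AllSteps-map (λ f m → not-true λ q →
                true≢false (trans (sym m) (trans (proj₁ wfI f ed (sameEdge-trans f (inj₁ (v , u , inv h)) ed (sameEdge-sym (inj₁ (v , u , inv h)) f q) cl~ed)) notin))) P (AllSteps-mem P))

      cycleThrough : (P : Walk I u v) → Simple P → Σ (Cycle T) λ B → (Balanced B → gain P · inv h ≡ e) × (gain P · inv h ≡ e → Balanced B) × InCycle B ed × OnCycle B u
      cycleThrough [] _ = ⊥-elim (lem eq nd)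
        where
        lem : ed ≡ inj₁ (u , u , h) → NonDegenerate ed → ⊥
        lem refl n = n refl
      cycleThrough (st y' g p P') sP =
        C.cycle , (λ b → trans (cong (_· inv h) (sym gP)) (C.cycle-balanced⁻ b)) ,
        (λ q → C.cycle-balanced (trans (cong (_· inv h) gP) q)) ,
        inCycle-resp C.cycle (inj₁ (v , u , inv h)) ed cl~ed C.cycle-∋-closing , C.cycle-on-start
        where
        module C = CloseUp v u (inv h) cl g (subIT _ p) (mapWalk subIT P') (simple-map subIT (st y' g p P') sP) (alP (st y' g p P'))
        gP : gain (mapWalk subIT (st y' g p P')) ≡ gain (st y' g p P')
        gP = gain-mapWalk subIT (st y' g p P')

      connectedUnbalanced : Independent T → Walk I u v → Unbalanced I u → ⊥
      connectedUnbalanced indT w ub with unbalanced⇒cycle wfI ub | simplify w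
      ... | (D , nbD , y , oD , wd) | (P , sP) with cycleThrough P sP
      ... | (B , b1 , b2 , inB , onB) with balanced? B
      ...   | yes b = proj₁ indT B b
      ...   | no nb = clash indT B inB nb D nbD u y onB oD (mapWalk subIT wd)

      bothUnbalanced : Independent T → Unbalanced I u → Unbalanced I v → ⊥
      bothUnbalanced indT ub vb with walk? u v
      ... | yes w = connectedUnbalanced indT w ub
      ... | no nw with unbalanced⇒cycle wfI ub | unbalanced⇒cycle wfI vb
      ... | (Cu , nbu , yu , ou , wu) | (Cv , nbv , yv , ov , wv) = nw wuv
        where
        edgeT : Walk T u v
        edgeT = st v h (subst (λ z → mem T z ≡ true) eq (insert-has I ed)) []
        wT : Walk T yu yv
        wT = rev wfT (mapWalk subIT wu) ++W (edgeT ++W mapWalk subIT wv)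
        se = proj₂ indT (mapCycle subIT Cu) (mapCycle subIT Cv) (λ b → nbu (mapCycle-balanced⁻ subIT Cu b)) (λ b → nbv (mapCycle-balanced⁻ subIT Cv b))
               (yu , yv , mapCycle-on subIT Cu yu ou , mapCycle-on subIT Cv yv ov , walk→star wT)
        f = proj₁ (someEdgeOf Cu)
        inU = proj₂ (someEdgeOf Cu)
        inV : InCycle Cv f
        inV = mapCycle-in⁻ subIT Cv f (proj₁ (se f) (mapCycle-in subIT Cu f inU))
        wuv : Walk I u v
        wuv = wu ++W (CycleWalks.cycle-connected wfI Cu yu (source f) ou (inCycle-on Cu f inU) ++W
                       (CycleWalks.cycle-connected wfI Cv (source f) yv (inCycle-on Cv f inV) ov ++W rev wfI wv))

      matchingGain : Independent T → (w : Walk I u v) → gain w ≡ h → ⊥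
      matchingGain indT w gw with simplify-or-cycle w
      ... | inj₂ (z , wz , cd) = connectedUnbalanced indT w (unbalanced-of-cycle wfI wz cd)
      ... | inj₁ (P , sP , gP) with cycleThrough P sP
      ... | (B , b1 , b2 , inB , onB) = proj₁ indT B (b2 (trans (cong (_· inv h) (trans gP gw)) (inverseʳ h)))

  independent-insert⇒¬span : ∀ {I : ESet G nv} (wfI : WF I) ed (nd : NonDegenerate ed) (notin : mem I ed ≡ false) → Independent (insert I ed) → ¬ Span I ed
  independent-insert⇒¬span {I} wfI (inj₂ v) nd notin indT ub with unbalanced⇒cycle wfI ub
  ... | (D , nbD , y , oD , wd) = InsertIndependent.clash wfI (inj₂ v) nd notin indT (loopC v (insert-has I (inj₂ v))) (sameEdge-refl (inj₂ v)) (λ ())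
                                    D nbD v y refl oD (mapWalk (insert-⊆ (inj₂ v)) wd)
  independent-insert⇒¬span wfI (inj₁ (u , v , h)) nd notin indT (inj₁ (ub , vb)) = InsertIndependent.EdgeCase.bothUnbalanced wfI _ nd notin u v h refl indT ub vb
  independent-insert⇒¬span wfI (inj₁ (u , v , h)) nd notin indT (inj₂ (inj₁ (w , ub))) = InsertIndependent.EdgeCase.connectedUnbalanced wfI _ nd notin u v h refl indT w ub
  independent-insert⇒¬span wfI (inj₁ (u , v , h)) nd notin indT (inj₂ (inj₂ (w , gw))) = InsertIndependent.EdgeCase.matchingGain wfI _ nd notin u v h refl indT w gw

  AllSteps-zip : ∀ {T : ESet G nv} {P Q : E → Set} {a b} (W : Walk T a b) → AllSteps P W → AllSteps Q W → AllSteps (λ f → P f × Q f) W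
  AllSteps-zip [] _ _ = tt
  AllSteps-zip (st y h p W) (x , r) (x' , r') = (x , x') , AllSteps-zip W r r'

  walkIn-AllSteps : ∀ {S T : ESet G nv} {P : E → Set} {a b} (R : Walk T a b) al → AllSteps P R → AllSteps P (walkIn {S} R al)
  walkIn-AllSteps [] _ _ = tt
  walkIn-AllSteps (st y h p R) (q , r) (x , r') = x , walkIn-AllSteps R r r'

  AllSteps-rev : ∀ {S : ESet G nv} (wf : WF S) {P : E → Set} → (∀ f f' → sameEdge f f' ≡ true → P f → P f') →
              ∀ {a b} (W : Walk S a b) → AllSteps P W → AllSteps P (rev wf W)
  AllSteps-rev wf resp [] _ = tt
  AllSteps-rev wf {P} resp {a} (st y h p W) (x , r) =
    AllSteps-++ (rev wf W) (st a (inv h) (mem-flip⁺ wf p) []) (AllSteps-rev wf resp W r) (resp _ _ (sameEdge-flip a y h) x , tt)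

  module InsertEdge {I : ESet G nv} (wfI : WF I) (u v : V) (h : Gr) (nd : u ≢ v)
                 (notin : mem I (inj₁ (u , v , h)) ≡ false) (indI : Independent I)
                 (nsp : ¬ Span I (inj₁ (u , v , h))) where
    ed : E
    ed = inj₁ (u , v , h)
    T = insert I ed
    wfT : WF T
    wfT = WF-insert wfI ed nd
    subIT : I ⊆ T
    subIT = insert-⊆ ed
    open EdgeInsertion I u v h

    restrictToI : (C : Cycle T) → ¬ InCycle C ed → Cycle I
    restrictToI C nin = restrictCycle C λ f q → [ (λ x → x) , (λ s → ⊥-elim (nin (inCycle-resp C f ed s q))) ] (mem-insert f (inCycle-mem wfT C f q))

    arcAvoiding : (C : Cycle T) → InCycle C ed → Σ (Walk I u v) λ W → (Balanced C → gain W ≡ h) × AllSteps (InCycle C) W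
    arcAvoiding (loopC w p) ()
    arcAvoiding (polyC k vs inj gs ms dist) (i , qi) with arc {T = T} (polygon vs gs ms) i
    ... | (R , stR , b1 , b2) = result (sameEdge-ends u v h (vs i) (vs (next′ i)) (gs i) qi)
      where
      C : Cycle T
      C = polyC k vs inj gs ms dist
      f∈I : ∀ f → (Σ (Fin _) λ j → (j ≢ i) × sameEdge f (polyEdge′ vs gs j) ≡ true) × mem T f ≡ true → mem I f ≡ true × InCycle C f
      f∈I f ((j , ne , s) , m) with mem-insert f m
      ... | inj₁ mi = mi , j , s
      ... | inj₂ se = ⊥-elim (true≢false (trans (sym (sameEdge-trans (polyEdge′ vs gs j) f (polyEdge′ vs gs i) (sameEdge-sym f _ s) (sameEdge-trans f ed _ se qi))) (dist j i ne)))
      stI : AllSteps (λ f → mem I f ≡ true × InCycle C f) R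
      stI = AllSteps-map f∈I R (AllSteps-zip R stR (AllSteps-mem R))
      RI : Walk I (vs (next′ i)) (vs i)
      RI = walkIn R (AllSteps-map (λ f → proj₁) R stI)
      gRI : gain RI ≡ gain R
      gRI = gain-walkIn R _
      result : (u ≡ vs i × v ≡ vs (next′ i) × h ≡ gs i) ⊎ (u ≡ vs (next′ i) × v ≡ vs i × h ≡ inv (gs i)) →
               Σ (Walk I u v) λ W → (Balanced C → gain W ≡ h) × AllSteps (InCycle C) W
      result (inj₁ (refl , refl , refl)) = rev wfI RI ,
        (λ b → trans (gain-rev wfI RI) (trans (cong inv gRI) (sym (inverseˡ-unique (gs i) (gain R) (b2 b))))) ,
        AllSteps-rev wfI (λ f f' s q → inCycle-resp C f f' s q) RI (walkIn-AllSteps R _ (AllSteps-map (λ f → proj₂) R stI))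
      result (inj₂ (refl , refl , refl)) = RI ,
        (λ b → trans gRI (inverseʳ-unique (gs i) (gain R) (b2 b))) ,
        walkIn-AllSteps R _ (AllSteps-map (λ f → proj₂) R stI)

    noBalancedCycle : ∀ (C : Cycle T) → ¬ Balanced C
    noBalancedCycle C b with inCycle? C ed
    ... | yes inC = nsp (inj₂ (inj₂ (proj₁ (arcAvoiding C inC) , proj₁ (proj₂ (arcAvoiding C inC)) b)))
    ... | no nin = proj₁ indI (restrictToI C nin) (restrictCycle-balanced C _ b)

    mixedComponent : (C D : Cycle T) → InCycle C ed → (nin : ¬ InCycle D ed) → ¬ Balanced D → ∀ x y → OnCycle C x → OnCycle D y → Walk T x y → ⊥
    mixedComponent C D inC nin nbD x y oC oD wxy = nsp (inj₂ (inj₁ (W , unbalanced-transport wfI wuy unbY)))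
      where
      W = proj₁ (arcAvoiding C inC)
      D' = restrictToI D nin
      unbY : Unbalanced I y
      unbY = CycleWalks.cycle-unbalanced wfI D' (λ b → nbD (restrictCycle-balanced⁻ D _ b)) y (restrictCycle-on D _ y oD)
      wuyT : Walk T u y
      wuyT = CycleWalks.cycle-connected wfT C u x (inCycle-on C ed inC) oC ++W wxy
      wuy : Walk I u y
      wuy = reroute wfI W wuyT (steps-old-or-new wuyT)

    -- If an edge f of C is not on D, then C − f, with the new edge rerouted along D, joins the ends of f in I − f;
    -- so f closes a cycle of I in the (balanced) component of u, which can be neither balanced nor unbalanced.
    module UniqueCycle (k : ℕ) (vs : Fin (suc (suc k)) → V) (inj : Injective _≡_ _≡_ vs) (gs : Fin (suc (suc k)) → Gr) (ms : ∀ i → mem T (polyEdge′ vs gs i) ≡ true)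
                 (dist : ∀ i j → i ≢ j → sameEdge (polyEdge′ vs gs i) (polyEdge′ vs gs j) ≡ false) (D : Cycle T) (inD : InCycle D ed)
                 (nub : ¬ Unbalanced I u) (f : E) (j : Fin (suc (suc k))) (sfj : sameEdge f (polyEdge′ vs gs j) ≡ true) (nfD : ¬ InCycle D f)
                 (inC : InCycle {S = T} (polyC k vs inj gs ms dist) ed) where
      C : Cycle T
      C = polyC k vs inj gs ms dist
      f≁ed : sameEdge f ed ≡ true → ⊥
      f≁ed s = nfD (inCycle-resp D ed f (sameEdge-sym f ed s) inD)
      S' = remove I f
      wfS' : WF S'
      wfS' = WF-remove wfI f
      notf : ∀ g → (sameEdge g f ≡ true → ⊥) → mem I g ≡ true → mem S' g ≡ true
      notf g n m = ∧-intro m (cong not (not-true (λ q → n q)))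
      thD = arcAvoiding D inD
      WD' : Walk S' u v
      WD' = walkIn (proj₁ thD) (AllSteps-map (λ g → λ { (m , ic) → notf g (λ s → nfD (inCycle-resp D g f s ic)) m })
              (proj₁ thD) (AllSteps-zip (proj₁ thD) (AllSteps-mem (proj₁ thD)) (proj₂ (proj₂ thD))))
      rj = arc {T = T} (polygon vs gs ms) j
      R = proj₁ rj
      stepOK : ∀ g → (Σ (Fin _) λ j' → (j' ≢ j) × sameEdge g (polyEdge′ vs gs j') ≡ true) × mem T g ≡ true → mem S' g ≡ true ⊎ sameEdge g ed ≡ true
      stepOK g ((j' , ne , s) , m) with mem-insert g m
      ... | inj₂ se = inj₂ se
      ... | inj₁ mi = inj₁ (notf g (λ sgf → true≢false (trans (sym (sameEdge-trans (polyEdge′ vs gs j') g (polyEdge′ vs gs j) (sameEdge-sym g _ s) (sameEdge-trans g f _ sgf sfj))) (dist j' j ne))) mi)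
      W' : Walk S' (vs (next′ j)) (vs j)
      W' = reroute wfS' WD' R (AllSteps-map stepOK R (AllSteps-zip R (proj₁ (proj₂ rj)) (AllSteps-mem R)))
      clI : mem I (inj₁ (vs j , vs (next′ j) , gs j)) ≡ true
      clI with mem-insert _ (ms j)
      ... | inj₁ m = m
      ... | inj₂ se = ⊥-elim (f≁ed (sameEdge-trans f _ ed sfj se))
      subS : S' ⊆ I
      subS = remove-⊆ f
      notInS' : ∀ g → mem S' g ≡ true → sameEdge g f ≡ true → ⊥
      notInS' g m s = true≢false (trans (sym m) (trans (cong (λ b → mem I g ∧ not b) s) (Boolₚ.∧-zeroʳ (mem I g))))

      WuI : ∀ z → OnCycle C z → Walk I u z
      WuI z oz = reroute wfI (proj₁ (arcAvoiding C inC)) wT (steps-old-or-new wT)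
        where wT = CycleWalks.cycle-connected wfT C u z (inCycle-on C ed inC) oz

      finish : (B : Cycle I) → OnCycle B (vs (next′ j)) → Dec (Balanced B) → ⊥
      finish B _ (yes b) = proj₁ indI B b
      finish B oB (no nb) = nub (unbalanced-transport wfI (WuI (vs (next′ j)) (next′ j , refl)) (CycleWalks.cycle-unbalanced wfI B nb (vs (next′ j)) oB))

      absurd-walk : ∀ {a b} (P : Walk S' a b) → Simple P → a ≡ vs (next′ j) → b ≡ vs j → ⊥
      absurd-walk [] _ q1 q2 = next′≢ j (inj (trans (sym q1) q2))
      absurd-walk (st y' g p P') sP refl refl = finish C.cycle C.cycle-on-start (balanced? C.cycle)
        where
        P : Walk S' (vs (next′ j)) (vs j)
        P = st y' g p P'
        al : AllSteps (λ x → sameEdge (inj₁ (vs j , vs (next′ j) , gs j)) x ≡ false) (mapWalk subS P)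
        al = AllSteps-mapWalk subS P (AllSteps-map (λ x m → not-true λ q → notInS' x m
                (sameEdge-trans x (polyEdge′ vs gs j) f (sameEdge-sym (polyEdge′ vs gs j) x q) (sameEdge-sym f (polyEdge′ vs gs j) sfj))) P (AllSteps-mem P))
        module C = CloseUp (vs j) (vs (next′ j)) (gs j) clI g (subS _ p) (mapWalk subS P') (simple-map subS P sP) al

      absurd : ⊥
      absurd = absurd-walk (proj₁ (simplify W')) (proj₂ (simplify W')) refl refl

    through-new-edge-⊆ : (C D : Cycle T) → InCycle C ed → InCycle D ed → ¬ Unbalanced I u → ∀ f → InCycle C f → InCycle D f
    through-new-edge-⊆ (loopC w p) D () inD nub f inCf
    through-new-edge-⊆ (polyC k vs inj gs ms dist) D inC inD nub f (j , sfj) with inCycle? D f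
    ... | yes q = q
    ... | no nD = ⊥-elim (UniqueCycle.absurd k vs inj gs ms dist D inD nub f j sfj nD inC)

    unbalancedCyclesAgree : ∀ (C D : Cycle T) → ¬ Balanced C → ¬ Balanced D → SameComponent C D → SameEdges C D
    unbalancedCyclesAgree C D nbC nbD (x , y , oC , oD , c) with inCycle? C ed | inCycle? D ed
    ... | yes inC | no nD = ⊥-elim (mixedComponent C D inC nD nbD x y oC oD (star→walk c))
    ... | no nC | yes inD = ⊥-elim (mixedComponent D C inD nC nbC y x oD oC (rev wfT (star→walk c)))
    ... | yes inC | yes inD = λ f → through-new-edge-⊆ C D inC inD nub f , through-new-edge-⊆ D C inD inC nub f
      where
      nub : ¬ Unbalanced I u
      nub ub = nsp (inj₂ (inj₁ (proj₁ (arcAvoiding C inC) , ub)))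
    ... | no nC | no nD = body
      where
      C' = restrictToI C nC
      D' = restrictToI D nD
      nbC' : ¬ Balanced C'
      nbC' b = nbC (restrictCycle-balanced⁻ C _ b)
      nbD' : ¬ Balanced D'
      nbD' b = nbD (restrictCycle-balanced⁻ D _ b)
      conv : Walk I x y → SameEdges C D
      conv W = λ f → (λ i → restrictCycle-in⁻ D _ f (proj₁ (se f) (restrictCycle-in C _ f i))) , (λ i → restrictCycle-in⁻ C _ f (proj₂ (se f) (restrictCycle-in D _ f i)))
        where
        se = proj₂ indI C' D' nbC' nbD' (x , y , restrictCycle-on C _ x oC , restrictCycle-on D _ y oD , walk→star W)
      ux : Unbalanced I x
      ux = CycleWalks.cycle-unbalanced wfI C' nbC' x (restrictCycle-on C _ x oC)
      uy : Unbalanced I y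
      uy = CycleWalks.cycle-unbalanced wfI D' nbD' y (restrictCycle-on D _ y oD)
      W = star→walk c
      body : SameEdges C D
      body with walk? u v
      ... | yes wuv = conv (reroute wfI wuv W (steps-old-or-new W))
      ... | no _ with decompose W
      ...   | inj₁ WI = conv WI
      ...   | inj₂ (inj₁ (Wxu , Wvy)) = ⊥-elim (nsp (inj₁ (unbalanced-transport wfI (rev wfI Wxu) ux , unbalanced-transport wfI Wvy uy)))
      ...   | inj₂ (inj₂ (Wxv , Wuy)) = ⊥-elim (nsp (inj₁ (unbalanced-transport wfI Wuy uy , unbalanced-transport wfI (rev wfI Wxv) ux)))

    independent-insert : Independent T
    independent-insert = noBalancedCycle , unbalancedCyclesAgree

  module InsertLoop {I : ESet G nv} (wfI : WF I) (v : V)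
                 (notin : mem I (inj₂ v) ≡ false) (indI : Independent I)
                 (nsp : ¬ Unbalanced I v) where
    ed : E
    ed = inj₂ v
    T = insert I ed
    wfT : WF T
    wfT = WF-insert wfI ed tt

    walkInI : ∀ {a b} → Walk T a b → Walk I a b
    walkInI [] = []
    walkInI (st y h p W) = st y h (trans (sym (Boolₚ.∨-identityʳ _)) p) (walkInI W)

    resH : (C : Cycle T) → ¬ InCycle C ed → ∀ f → InCycle C f → mem I f ≡ true
    resH C nin f q = [ (λ x → x) , (λ s → ⊥-elim (nin (inCycle-resp C f ed s q))) ] (∨-true (inCycle-mem wfT C f q))

    restrictToI : (C : Cycle T) → ¬ InCycle C ed → Cycle I
    restrictToI C nin = restrictCycle C (resH C nin)

    noBalancedCycle : ∀ (C : Cycle T) → ¬ Balanced C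
    noBalancedCycle (loopC w p) b = b
    noBalancedCycle (polyC k vs inj gs ms dist) b = proj₁ indI (restrictToI C nin) (restrictCycle-balanced C (resH C nin) b)
      where
      C : Cycle T
      C = polyC k vs inj gs ms dist
      nin : ¬ InCycle C ed
      nin (i , ())

    mixedComponent : (C D : Cycle T) → InCycle C ed → (nin : ¬ InCycle D ed) → ¬ Balanced D → ∀ x y → OnCycle C x → OnCycle D y → Walk T x y → ⊥
    mixedComponent C D inC nin nbD x y oC oD wxy = nsp (unbalanced-transport wfI (walkInI (CycleWalks.cycle-connected wfT C v x (inCycle-on C ed inC) oC ++W wxy)) unbY)
      where
      unbY : Unbalanced I y
      unbY = CycleWalks.cycle-unbalanced wfI (restrictToI D nin) (λ b → nbD (restrictCycle-balanced⁻ D _ b)) y (restrictCycle-on D _ y oD)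

    unbalancedCyclesAgree : ∀ (C D : Cycle T) → ¬ Balanced C → ¬ Balanced D → SameComponent C D → SameEdges C D
    unbalancedCyclesAgree C D nbC nbD (x , y , oC , oD , c) with inCycle? C ed | inCycle? D ed
    ... | yes inC | no nD = ⊥-elim (mixedComponent C D inC nD nbD x y oC oD (star→walk c))
    ... | no nC | yes inD = ⊥-elim (mixedComponent D C inD nC nbC y x oD oC (rev wfT (star→walk c)))
    ... | yes inC | yes inD = both C D inC inD
      where
      both : (C D : Cycle T) → InCycle C ed → InCycle D ed → SameEdges C D
      both (loopC w p) (loopC w' p') inC inD with ⌊≟⌋-sound v w inC | ⌊≟⌋-sound v w' inD
      ... | refl | refl = λ f → (λ i → i) , (λ i → i)
      both (polyC _ _ _ _ _ _) _ (_ , ()) _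
      both (loopC _ _) (polyC _ _ _ _ _ _) _ (_ , ())
    ... | no nC | no nD = λ f → (λ i → restrictCycle-in⁻ D _ f (proj₁ (se f) (restrictCycle-in C _ f i))) , (λ i → restrictCycle-in⁻ C _ f (proj₂ (se f) (restrictCycle-in D _ f i)))
      where
      se = proj₂ indI (restrictToI C nC) (restrictToI D nD) (λ b → nbC (restrictCycle-balanced⁻ C _ b)) (λ b → nbD (restrictCycle-balanced⁻ D _ b))
             (x , y , restrictCycle-on C _ x oC , restrictCycle-on D _ y oD , walk→star (walkInI (star→walk c)))

    independent-insert : Independent T
    independent-insert = noBalancedCycle , unbalancedCyclesAgree

  ¬span⇒independent-insert : ∀ {I : ESet G nv} (wfI : WF I) ed (nd : NonDegenerate ed) (notin : mem I ed ≡ false) → Independent I → ¬ Span I ed → Independent (insert I ed)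
  ¬span⇒independent-insert wfI (inj₁ (u , v , h)) nd notin indI nsp = InsertEdge.independent-insert wfI u v h nd notin indI nsp
  ¬span⇒independent-insert wfI (inj₂ v) nd notin indI nsp = InsertLoop.independent-insert wfI v notin indI nsp

module BalancedRoots (G : FinGroup) (nv : ℕ) (key : Fin nv → ℕ) (key-injective : ∀ a b → key a ≡ key b → a ≡ b) where
  open GroupLemmas G
  open EdgeSets G nv
  open Walks G nv
  open Cycles G nv
  open Independence G nv

  -- β S counts the balanced components of S, each through its key-least vertex (its Root).
  Minimal : ESet G nv → V → Set
  Minimal S x = ∀ w → key w < key x → ¬ Walk S w x

  Root : ESet G nv → V → Set
  Root S x = (¬ Unbalanced S x) × Minimal S x

  root? : ∀ {S : ESet G nv} → WF S → ∀ x → Dec (Root S x)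
  root? wf x = ¬? (unbalanced? wf x) ×-dec
    all? (λ w → (key w <? key x) →-dec ¬? (walk? w x))

  β : (S : ESet G nv) → WF S → ℕ
  β S wf = count (λ x → ⌊ root? wf x ⌋) (allFin nv)

  β-cong : ∀ {S S' : ESet G nv} (wf : WF S) (wf' : WF S') → (∀ x → Root S x → Root S' x) → (∀ x → Root S' x → Root S x) → β S wf ≡ β S' wf'
  β-cong wf wf' f g = count-ext (λ x → dec-agree (root? wf x) (root? wf' x) (f x) (g x)) (allFin nv)

  β-mono : ∀ {S S' : ESet G nv} (wf : WF S) (wf' : WF S') → (∀ x → Root S x → Root S' x) → β S wf ≤ β S' wf'
  β-mono wf wf' f = count-mono (λ x q → dec-true (root? wf' x) (f x (dec-sound (root? wf x) q))) (allFin nv)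

  β-≤ : ∀ (S : ESet G nv) wf → β S wf ≤ nv
  β-≤ S wf = ℕₚ.≤-trans (count-≤-len _ (allFin nv)) (ℕₚ.≤-reflexive (Listₚ.length-tabulate (λ i → i)))

  module _ {S : ESet G nv} (wf : WF S) where
    rootOf-bounded : ∀ n x → key x < n → Σ V λ r → Walk S r x × Minimal S r
    rootOf-bounded zero x ()
    rootOf-bounded (suc n) x (s≤s kx) with any? (λ w → (key w <? key x) ×-dec walk? w x)
    ... | yes (w , lt , W) with rootOf-bounded n w (ℕₚ.<-≤-trans lt kx)
    ...   | (r , Wr , mr) = r , Wr ++W W , mr
    rootOf-bounded (suc n) x (s≤s kx) | no nw = x , [] , λ w lt W → nw (w , lt , W)

    rootOf : ∀ x → Σ V λ r → Walk S r x × Minimal S r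
    rootOf x = rootOf-bounded (suc (key x)) x (ℕₚ.n<1+n _)

    minimal-unique : ∀ {r r'} → Minimal S r → Minimal S r' → Walk S r r' → r ≡ r'
    minimal-unique {r} {r'} m m' W with ℕₚ.<-cmp (key r) (key r')
    ... | tri< lt _ _ = ⊥-elim (m' r lt W)
    ... | tri≈ _ eq _ = key-injective r r' eq
    ... | tri> _ _ gt = ⊥-elim (m r' gt (rev wf W))

  module SpanInvariance {Z Z' : ESet G nv} (wfZ : WF Z) (wfZ' : WF Z') (sub : Z ⊆ Z') (sp : ∀ f → mem Z' f ≡ true → Span Z f) where
    conv : ∀ {a b} → ¬ Unbalanced Z a → (W : Walk Z' a b) → Σ (Walk Z a b) λ W' → gain W' ≡ gain W
    conv nb [] = [] , refl
    conv {a} nb (st y g p W) with sp _ p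
    ... | inj₁ (ua , _) = ⊥-elim (nb ua)
    ... | inj₂ (inj₁ (_ , ua)) = ⊥-elim (nb ua)
    ... | inj₂ (inj₂ (W1 , gW1)) with conv (λ uy → nb (unbalanced-transport wfZ W1 uy)) W
    ...   | (W' , gW') = W1 ++W W' , trans (gain-++ W1 W') (cong₂ _·_ gW1 gW')

    root⇒ : ∀ x → Root Z x → Root Z' x
    root⇒ x (nb , mn) = nb' , mn'
      where
      nb' : ¬ Unbalanced Z' x
      nb' (inj₁ (y , W , l)) = nb (unbalanced-transport wfZ (proj₁ (conv nb W)) (sp _ l))
      nb' (inj₂ (c , nt)) = nb (inj₂ (proj₁ (conv nb c) , λ q → nt (trans (sym (proj₂ (conv nb c))) q)))
      mn' : Minimal Z' x
      mn' w lt W = mn w lt (rev wfZ (proj₁ (conv nb (rev wfZ' W))))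

    root⇐ : ∀ x → Root Z' x → Root Z x
    root⇐ x (nb , mn) = (λ u → nb (unbalanced-mono sub u)) , λ w lt W → mn w lt (mapWalk sub W)

    β-eq : β Z' wfZ' ≡ β Z wfZ
    β-eq = β-cong wfZ' wfZ root⇐ root⇒

  β-drop : ∀ {S S' : ESet G nv} (wf : WF S) (wf' : WF S') r → Root S r → ¬ Root S' r →
    (∀ x → x ≢ r → Root S x → Root S' x) → (∀ x → x ≢ r → Root S' x → Root S x) → β S wf ≡ suc (β S' wf')
  β-drop {S} {S'} wf wf' r rr nr f g =
    trans (count-diff _≟_ r {p = λ x → ⌊ root? wf' x ⌋} {q = λ x → ⌊ root? wf x ⌋} (dec-false (root? wf' r) nr) (dec-true (root? wf r) rr)
             (λ x ne → dec-agree (root? wf' x) (root? wf x) (g x ne) (f x ne)) (allFin nv))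
      (trans (cong (count (λ x → ⌊ root? wf' x ⌋) (allFin nv) +_) (count-allFin-single (λ x → ⌊ x ≟ r ⌋) r (⌊≟⌋-refl r) (λ x ne → ⌊≟⌋-false ne)))
        (ℕₚ.+-comm _ 1))

  root-mono : ∀ {S S' : ESet G nv} → S ⊆ S' → ∀ x → Root S' x → Root S x
  root-mono sub x (nb , mn) = (λ u → nb (unbalanced-mono sub u)) , (λ w lt W → mn w lt (mapWalk sub W))

  module InsertLoopβ {S : ESet G nv} (wf : WF S) (v : V) (notin : mem S (inj₂ v) ≡ false) (nub : ¬ Unbalanced S v) where
    S' = insert S (inj₂ v)
    wf' : WF S'
    wf' = WF-insert wf (inj₂ v) tt

    walkWithoutLoop : ∀ {a b} (W : Walk S' a b) → Σ (Walk S a b) λ W' → gain W' ≡ gain W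
    walkWithoutLoop [] = [] , refl
    walkWithoutLoop (st y h p W) = st y h (trans (sym (Boolₚ.∨-identityʳ _)) p) (proj₁ (walkWithoutLoop W)) , cong (h ·_) (proj₂ (walkWithoutLoop W))

    unbalanced-insert-loop : ∀ {x} → Unbalanced S' x → Unbalanced S x ⊎ Walk S x v
    unbalanced-insert-loop (inj₁ (y , W , l)) with ∨-true l
    ... | inj₁ l' = inj₁ (inj₁ (y , proj₁ (walkWithoutLoop W) , l'))
    ... | inj₂ q = inj₂ (subst (Walk S _) (⌊≟⌋-sound y v q) (proj₁ (walkWithoutLoop W)))
    unbalanced-insert-loop (inj₂ (c , nt)) = inj₁ (inj₂ (proj₁ (walkWithoutLoop c) , λ q → nt (trans (sym (proj₂ (walkWithoutLoop c))) q)))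

    r = proj₁ (rootOf wf v)
    Wrv = proj₁ (proj₂ (rootOf wf v))
    minr = proj₂ (proj₂ (rootOf wf v))

    step : β S wf ≡ suc (β S' wf')
    step = β-drop wf wf' r (rS , minr) nrS' f (λ x _ → root-mono (insert-⊆ (inj₂ v)) x)
      where
      rS : ¬ Unbalanced S r
      rS u = nub (unbalanced-transport wf (rev wf Wrv) u)
      nrS' : ¬ Root S' r
      nrS' (nb , _) = nb (inj₁ (v , mapWalk (insert-⊆ (inj₂ v)) Wrv , insert-has S (inj₂ v)))
      f : ∀ x → x ≢ r → Root S x → Root S' x
      f x ne (nb , mn) = nb' , mn'
        where
        nb' : ¬ Unbalanced S' x
        nb' u with unbalanced-insert-loop u
        ... | inj₁ u' = nb u'
        ... | inj₂ W = ne (minimal-unique wf mn minr (W ++W rev wf Wrv))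
        mn' : Minimal S' x
        mn' w lt W = mn w lt (proj₁ (walkWithoutLoop W))

  module InsertEdgeβ {S : ESet G nv} (wf : WF S) (u v : V) (h : Gr) (nd : u ≢ v) (notin : mem S (inj₁ (u , v , h)) ≡ false) where
    ed : E
    ed = inj₁ (u , v , h)
    S' = insert S ed
    wf' : WF S'
    wf' = WF-insert wf ed nd
    sub : S ⊆ S'
    sub = insert-⊆ ed
    eS' : mem S' (inj₁ (u , v , h)) ≡ true
    eS' = insert-has S ed
    eS'r : mem S' (inj₁ (v , u , inv h)) ≡ true
    eS'r = mem-flip⁺ wf' eS'

    open EdgeInsertion S u v h

    walk-avoiding : ∀ {a b} → ¬ Walk S a u → ¬ Walk S a v → (W : Walk S' a b) → Σ (Walk S a b) λ W' → gain W' ≡ gain W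
    walk-avoiding nu nv' [] = [] , refl
    walk-avoiding {a} nu nv' (st y g p W) with mem-insert _ p
    ... | inj₂ s with sameEdge-ends a y g u v h s
    ...   | inj₁ (refl , _ , _) = ⊥-elim (nu [])
    ...   | inj₂ (refl , _ , _) = ⊥-elim (nv' [])
    walk-avoiding {a} nu nv' (st y g p W) | inj₁ m with walk-avoiding (λ W' → nu (st y g m W')) (λ W' → nv' (st y g m W')) W
    ... | (W' , gq) = st y g m W' , cong (g ·_) gq

    unbalanced-avoiding : ∀ {x} → ¬ Walk S x u → ¬ Walk S x v → Unbalanced S' x → Unbalanced S x
    unbalanced-avoiding nu nv' (inj₁ (y , W , l)) = inj₁ (y , proj₁ (walk-avoiding nu nv' W) , trans (sym (Boolₚ.∨-identityʳ _)) l)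
    unbalanced-avoiding nu nv' (inj₂ (c , nt)) = inj₂ (proj₁ (walk-avoiding nu nv' c) , λ q → nt (trans (sym (proj₂ (walk-avoiding nu nv' c))) q))

    module Bridge (nw : ¬ Walk S u v) (nub : ¬ Unbalanced S u) (nvb : ¬ Unbalanced S v) where
      -- Joining two balanced components by one edge: every vertex gets a well-defined gain from u, so no closed walk has nontrivial gain.
      Potential : V → Gr → Set
      Potential a g = (Σ (Walk S u a) λ W → gain W ≡ g) ⊎ (Σ (Walk S v a) λ W → g ≡ h · gain W)

      potential-step : ∀ {a b g t} → Potential a g → mem S' (inj₁ (a , b , t)) ≡ true → Potential b (g · t)
      potential-step {a} {b} {g} {t} P p with mem-insert _ p
      potential-step {a} {b} {g} {t} (inj₁ (W , gW)) p | inj₁ m = inj₁ (W ++W st b t m [] ,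
        trans (gain-++ W (st b t m [])) (cong₂ _·_ gW (identityʳ t)))
      potential-step {a} {b} {g} {t} (inj₂ (W , q)) p | inj₁ m = inj₂ (W ++W st b t m [] ,
        trans (cong (_· t) q) (trans (assoc h (gain W) t) (cong (h ·_) (sym (trans (gain-++ W (st b t m [])) (cong (gain W ·_) (identityʳ t)))))))
      ... | inj₂ s with sameEdge-ends a b t u v h s
      potential-step {a} {b} {g} {t} (inj₁ (W , gW)) p | inj₂ s | inj₁ (refl , refl , refl) =
        inj₂ ([] , trans (cong (_· h) g≡e) (trans (identityˡ h) (sym (identityʳ h))))
        where g≡e = trans (sym gW) (balanced-gain-unique wf nub W [])
      potential-step {a} {b} {g} {t} (inj₂ (W , q)) p | inj₂ s | inj₁ (refl , refl , refl) = ⊥-elim (nw (rev wf W))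
      potential-step {a} {b} {g} {t} (inj₁ (W , gW)) p | inj₂ s | inj₂ (refl , refl , q) = ⊥-elim (nw W)
      potential-step {a} {b} {g} {t} (inj₂ (W , q)) p | inj₂ s | inj₂ (refl , refl , q') =
        inj₁ ([] , sym (trans (cong₂ _·_ (trans q (trans (cong (h ·_) (balanced-gain-unique wf nvb W [])) (identityʳ h))) q') (inverseʳ h)))

      potential-walk : ∀ {a b g} → Potential a g → (W : Walk S' a b) → Potential b (g · gain W)
      potential-walk {g = g} P [] = subst (Potential _) (sym (identityʳ g)) P
      potential-walk {g = g} P (st y t p W) = subst (Potential _) (assoc g t (gain W)) (potential-walk (potential-step P p) W)

      potential-unique : ∀ {a g g'} → Potential a g → Potential a g' → g ≡ g'
      potential-unique (inj₁ (W , q)) (inj₁ (W' , q')) = trans (sym q) (trans (balanced-gain-unique wf nub W W') q')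
      potential-unique (inj₂ (W , q)) (inj₂ (W' , q')) = trans q (trans (cong (h ·_) (balanced-gain-unique wf nvb W W')) (sym q'))
      potential-unique (inj₁ (W , q)) (inj₂ (W' , q')) = ⊥-elim (nw (W ++W rev wf W'))
      potential-unique (inj₂ (W , q)) (inj₁ (W' , q')) = ⊥-elim (nw (W' ++W rev wf W))

      bridge : ¬ Unbalanced S' u
      bridge (inj₁ (y , W , l)) with potential-walk (inj₁ ([] , refl)) W
      ... | inj₁ (W' , _) = nub (unbalanced-transport wf W' (inj₁ (y , [] , trans (sym (Boolₚ.∨-identityʳ _)) l)))
      ... | inj₂ (W' , _) = nvb (unbalanced-transport wf W' (inj₁ (y , [] , trans (sym (Boolₚ.∨-identityʳ _)) l)))
      bridge (inj₂ (c , nt)) = nt (trans (sym (identityˡ (gain c))) (potential-unique (potential-walk (inj₁ ([] , refl)) c) (inj₁ ([] , refl))))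

    module Joined (Wuv : Walk S u v) (nsp : ¬ Span S ed) where
      nub : ¬ Unbalanced S u
      nub ub = nsp (inj₂ (inj₁ (Wuv , ub)))
      ng : gain Wuv ≢ h
      ng q = nsp (inj₂ (inj₂ (Wuv , q)))
      ru = proj₁ (rootOf wf u)
      Wru = proj₁ (proj₂ (rootOf wf u))
      minr = proj₂ (proj₂ (rootOf wf u))
      CW : Walk S' u u
      CW = mapWalk sub Wuv ++W st u (inv h) eS'r []
      unbS'u : Unbalanced S' u
      unbS'u = inj₂ (CW , λ q → ng (x∙y⁻¹≈ε⇒x≈y (gain Wuv) h
        (trans (cong₂ _·_ (sym (gain-mapWalk sub Wuv)) (sym (identityʳ (inv h)))) (trans (sym (gain-++ (mapWalk sub Wuv) (st u (inv h) eS'r []))) q))))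
      step : β S wf ≡ suc (β S' wf')
      step = β-drop wf wf' ru ((λ ur → nub (unbalanced-transport wf (rev wf Wru) ur)) , minr)
        (λ { (nb , _) → nb (unbalanced-transport wf' (mapWalk sub Wru) unbS'u) }) f (λ x _ → root-mono sub x)
        where
        f : ∀ x → x ≢ ru → Root S x → Root S' x
        f x ne (nb , mn) = nb' , (λ w lt W → mn w lt (reroute wf Wuv W (steps-old-or-new W)))
          where
          nb' : ¬ Unbalanced S' x
          nb' ux with walk? x u
          ... | yes Wxu = ne (minimal-unique wf mn minr (Wxu ++W rev wf Wru))
          ... | no nxu = nb (unbalanced-avoiding nxu (λ Wxv → nxu (Wxv ++W rev wf Wuv)) ux)

    ru = proj₁ (rootOf wf u)
    Wru = proj₁ (proj₂ (rootOf wf u))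
    minru = proj₂ (proj₂ (rootOf wf u))
    rv = proj₁ (rootOf wf v)
    Wrv = proj₁ (proj₂ (rootOf wf v))
    minrv = proj₂ (proj₂ (rootOf wf v))

    RootOfVLost = Unbalanced S u ⊎ ((¬ Unbalanced S u) × key ru < key rv)

    module Separate (nw : ¬ Walk S u v) (nvb : ¬ Unbalanced S v) (cond : RootOfVLost) where
      rvS : Root S rv
      rvS = (λ ur → nvb (unbalanced-transport wf (rev wf Wrv) ur)) , minrv
      not-root-after : RootOfVLost → ¬ Root S' rv
      not-root-after (inj₁ ub) (nb , mn) = nb (unbalanced-transport wf' (mapWalk sub Wrv ++W st u (inv h) eS'r []) (unbalanced-mono sub ub))
      not-root-after (inj₂ (_ , lt)) (nb , mn) = mn ru lt (mapWalk sub Wru ++W (st v h eS' [] ++W mapWalk sub (rev wf Wrv)))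
      f : ∀ x → x ≢ rv → Root S x → Root S' x
      f x ne (nb , mn) = nb' cond , mn' cond
        where
        mn' : RootOfVLost → Minimal S' x
        mn' c w lt W with decompose W
        ... | inj₁ Wwx = mn w lt Wwx
        ... | inj₂ (inj₁ (Wwu , Wvx)) = ne (minimal-unique wf mn minrv (rev wf Wvx ++W rev wf Wrv))
        mn' (inj₁ ub) w lt W | inj₂ (inj₂ (Wwv , Wux)) = nb (unbalanced-transport wf (rev wf Wux) ub)
        mn' (inj₂ (_ , lt')) w lt W | inj₂ (inj₂ (Wwv , Wux)) with minimal-unique wf minru mn (Wru ++W Wux)
        ... | refl with ℕₚ.<-cmp (key w) (key rv)
        ...   | tri< lt'' _ _ = minrv w lt'' (Wwv ++W rev wf Wrv)
        ...   | tri≈ _ eq _ = ℕₚ.<-irrefl refl (ℕₚ.<-trans lt (subst (key ru <_) (sym eq) lt'))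
        ...   | tri> _ _ gt = ℕₚ.<-asym (ℕₚ.<-trans lt lt') gt
        nb' : RootOfVLost → ¬ Unbalanced S' x
        nb' c ux with walk? x u
        nb' (inj₁ ub) ux | yes Wxu = nb (unbalanced-transport wf Wxu ub)
        nb' (inj₂ (nub , _)) ux | yes Wxu = Bridge.bridge nw nub nvb (unbalanced-transport wf' (mapWalk sub (rev wf Wxu)) ux)
        nb' c ux | no nxu with walk? x v
        ... | yes Wxv = ne (minimal-unique wf mn minrv (Wxv ++W rev wf Wrv))
        ... | no nxv = nb (unbalanced-avoiding nxu nxv ux)
      step : β S wf ≡ suc (β S' wf')
      step = β-drop wf wf' rv rvS (not-root-after cond) f (λ x _ → root-mono sub x)

  β-irrelevant : ∀ {S : ESet G nv} (wf wf' : WF S) → β S wf ≡ β S wf'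
  β-irrelevant wf wf' = β-cong wf wf' (λ _ x → x) (λ _ x → x)

  ≐⊆ : ∀ {A B : ESet G nv} → A ≐ B → A ⊆ B
  ≐⊆ eq f p = trans (sym (eq f)) p

  ≐sym : ∀ {A B : ESet G nv} → A ≐ B → B ≐ A
  ≐sym eq f = sym (eq f)

  β-≐ : ∀ {A B : ESet G nv} (wA : WF A) (wB : WF B) → A ≐ B → β A wA ≡ β B wB
  β-≐ wA wB eq = β-cong wA wB (λ x → root-mono (≐⊆ (≐sym eq)) x) (λ x → root-mono (≐⊆ eq) x)

  β-insert-reversed : ∀ {S : ESet G nv} (wf : WF S) u v h (nd : u ≢ v) (notin : mem S (inj₁ (u , v , h)) ≡ false) →
    ¬ Walk S u v → ¬ Unbalanced S u →
    InsertEdgeβ.RootOfVLost wf v u (inv h) (λ q → nd (sym q)) (trans (sym (mem-flip wf u v h)) notin) →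
    β S wf ≡ suc (β (insert S (inj₁ (u , v , h))) (WF-insert wf (inj₁ (u , v , h)) nd))
  β-insert-reversed {S} wf u v h nd notin nw nub c =
    trans (InsertEdgeβ.Separate.step wf v u (inv h) (λ q → nd (sym q)) (trans (sym (mem-flip wf u v h)) notin) (λ W → nw (rev wf W)) nub c)
          (cong suc (β-≐ _ _ (insert-cong S _ _ (sameEdge-sym (inj₁ (u , v , h)) (inj₁ (v , u , inv h)) (sameEdge-flip u v h)))))

  β-insert : ∀ {S : ESet G nv} (wf : WF S) ed (nd : NonDegenerate ed) (notin : mem S ed ≡ false) → ¬ Span S ed →
              β S wf ≡ suc (β (insert S ed) (WF-insert wf ed nd))
  β-insert {S} wf (inj₂ v) nd notin nsp = trans (InsertLoopβ.step wf v notin nsp) (cong suc (β-irrelevant _ _))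
  β-insert {S} wf (inj₁ (u , v , h)) nd notin nsp with walk? u v
  ... | yes Wuv = trans (InsertEdgeβ.Joined.step wf u v h nd notin Wuv nsp) (cong suc (β-irrelevant _ _))
  ... | no nw with unbalanced? wf u | unbalanced? wf v
  ...   | yes ub | yes vb = ⊥-elim (nsp (inj₁ (ub , vb)))
  ...   | yes ub | no nvb = trans (InsertEdgeβ.Separate.step wf u v h nd notin nw nvb (inj₁ ub)) (cong suc (β-irrelevant _ _))
  ...   | no nub | yes vb = β-insert-reversed wf u v h nd notin nw nub (inj₁ vb)
  ...   | no nub | no nvb with ℕₚ.<-cmp (key (InsertEdgeβ.ru wf u v h nd notin)) (key (InsertEdgeβ.rv wf u v h nd notin))
  ...     | tri< lt _ _ = trans (InsertEdgeβ.Separate.step wf u v h nd notin nw nvb (inj₂ (nub , lt))) (cong suc (β-irrelevant _ _))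
  ...     | tri> _ _ gt = β-insert-reversed wf u v h nd notin nw nub (inj₂ (nvb , gt))
  ...     | tri≈ _ eq _ = ⊥-elim (nw (rev wf (InsertEdgeβ.Wru wf u v h nd notin) ++W subst (λ z → Walk S z v) (sym (key-injective _ _ eq)) (InsertEdgeβ.Wrv wf u v h nd notin)))

module RankFormula (G : FinGroup) (nv : ℕ) (key : Fin nv → ℕ) (key-injective : ∀ a b → key a ≡ key b → a ≡ b) where
  open GroupLemmas G
  open EdgeSets G nv
  open Walks G nv
  open Cycles G nv
  open Independence G nv
  open BalancedRoots G nv key key-injective

  span-∈ : ∀ {I : ESet G nv} e → mem I e ≡ true → Span I e
  span-∈ (inj₂ v) p = inj₁ (v , [] , p)
  span-∈ (inj₁ (u , v , h)) p = inj₂ (inj₂ (st v h p [] , identityʳ h))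

  span-mono : ∀ {I J : ESet G nv} → I ⊆ J → ∀ e → Span I e → Span J e
  span-mono sub (inj₂ v) x = unbalanced-mono sub x
  span-mono sub (inj₁ (u , v , h)) (inj₁ (a , b)) = inj₁ (unbalanced-mono sub a , unbalanced-mono sub b)
  span-mono sub (inj₁ (u , v , h)) (inj₂ (inj₁ (W , a))) = inj₂ (inj₁ (mapWalk sub W , unbalanced-mono sub a))
  span-mono sub (inj₁ (u , v , h)) (inj₂ (inj₂ (W , q))) = inj₂ (inj₂ (mapWalk sub W , trans (gain-mapWalk sub W) q))

  nonDegenerate : ∀ {S : ESet G nv} → WF S → ∀ e → mem S e ≡ true → NonDegenerate e
  nonDegenerate wf (inj₁ (u , v , h)) p refl = true≢false (trans (sym p) (proj₂ wf u h))
  nonDegenerate wf (inj₂ v) p = tt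

  ∅ : ESet G nv
  ∅ = mkE (λ _ → false)

  element-or-empty : ∀ (I : ESet G nv) → (Σ E λ e → mem I e ≡ true) ⊎ (∀ e → mem I e ≡ false)
  element-or-empty I with any? (λ u → any? (λ v → any? (λ g →
                Boolₚ._≟_ (mem I (inj₁ (u , v , g))) true)))
  ... | yes (u , v , g , p) = inj₁ (inj₁ (u , v , g) , p)
  ... | no nt with any? (λ v → Boolₚ._≟_ (mem I (inj₂ v)) true)
  ...   | yes (v , p) = inj₁ (inj₂ v , p)
  ...   | no nl = inj₂ λ { (inj₁ (u , v , g)) → not-true (λ p → nt (u , v , g , p)) ; (inj₂ v) → not-true (λ p → nl (v , p)) }

  count-true : ∀ {A : Set} (p : A → Bool) → (∀ x → p x ≡ true) → ∀ xs → count p xs ≡ length xs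
  count-true p h [] = refl
  count-true p h (x ∷ xs) rewrite h x = cong suc (count-true p h xs)

  module Empty {I : ESet G nv} (wf : WF I) (emp : ∀ e → mem I e ≡ false) where
    walk-trivial : ∀ {a b} → Walk I a b → a ≡ b
    walk-trivial [] = refl
    walk-trivial (st y h p W) = ⊥-elim (true≢false (trans (sym p) (emp _)))

    all-roots : ∀ x → Root I x
    all-roots x = nb , (λ w lt W → ℕₚ.<-irrefl (cong key (walk-trivial W)) lt)
      where
      nb : ¬ Unbalanced I x
      nb (inj₁ (y , W , l)) = true≢false (trans (sym l) (emp _))
      nb (inj₂ ([] , nt)) = nt refl
      nb (inj₂ (st y h p W , nt)) = true≢false (trans (sym p) (emp _))

    β-all : β I wf ≡ nv
    β-all = trans (count-true _ (λ x → dec-true (root? wf x) (all-roots x)) (allFin nv)) (Listₚ.length-tabulate (λ i → i))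

    size-∅ : size I ≡ 0
    size-∅ = trans (size-split I) (cong₂ _+_ (count-false _ (λ { (u , v , g) → cong (_∧ _) (emp _) }) allTriplesAt) (count-false _ (λ v → emp (inj₂ v)) (allFin nv)))

  module Remove {I : ESet G nv} (wf : WF I) (e : E) (p : mem I e ≡ true) where
    I₀ = remove I e
    wf₀ : WF I₀
    wf₀ = WF-remove wf e
    eq : I ≐ insert I₀ e
    eq f with bool-cases (sameEdge f e)
    ... | inj₁ s rewrite s = trans (proj₁ wf f e s) (trans p (sym (Boolₚ.∨-zeroʳ _)))
    ... | inj₂ s rewrite s = sym (trans (Boolₚ.∨-identityʳ _) (Boolₚ.∧-identityʳ _))
    notin₀ : mem I₀ e ≡ false
    notin₀ = trans (cong (λ b → mem I e ∧ not b) (sameEdge-refl e)) (Boolₚ.∧-zeroʳ _)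
    nd : NonDegenerate e
    nd = nonDegenerate wf e p
    size-remove : size I ≡ suc (size I₀)
    size-remove = trans (size-ext {I} {insert I₀ e} eq) (size-insert wf₀ e nd notin₀)
    independent-reinsert : Independent I → Independent (insert I₀ e)
    independent-reinsert = independent-⊆ (≐⊆ (≐sym eq))

  size+β : ∀ n (I : ESet G nv) (wf : WF I) → Independent I → size I ≡ n → size I + β I wf ≡ nv
  size+β n I wf ind sz with element-or-empty I
  ... | inj₂ emp = trans (cong (_+ β I wf) (Empty.size-∅ wf emp)) (Empty.β-all wf emp)
  size+β zero I wf ind sz | inj₁ (e , p) = ⊥-elim (ℕₚ.0≢1+n (trans (sym sz) (Remove.size-remove wf e p)))
  size+β (suc n) I wf ind sz | inj₁ (e , p) =
    trans (cong (_+ β I wf) (Remove.size-remove wf e p)) (trans (sym (ℕₚ.+-suc _ _))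
      (trans (cong (size I₀ +_) (sym beq)) (size+β n I₀ (Remove.wf₀ wf e p) (independent-⊆ (remove-⊆ e) ind)
        (ℕₚ.suc-injective (trans (sym (Remove.size-remove wf e p)) sz)))))
    where
    I₀ = remove I e
    beq : β I₀ (Remove.wf₀ wf e p) ≡ suc (β I wf)
    beq = trans (β-insert (Remove.wf₀ wf e p) e (Remove.nd wf e p) (Remove.notin₀ wf e p)
                  (independent-insert⇒¬span (Remove.wf₀ wf e p) e (Remove.nd wf e p) (Remove.notin₀ wf e p) (Remove.independent-reinsert wf e p ind)))
            (cong suc (β-≐ _ _ (≐sym (Remove.eq wf e p))))

  independent-size : ∀ (I : ESet G nv) (wf : WF I) → Independent I → size I ≡ nv ∸ β I wf
  independent-size I wf ind = trans (sym (ℕₚ.m+n∸n≡m (size I) (β I wf))) (cong (_∸ β I wf) (size+β (size I) I wf ind refl))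

  independent-size≤ : ∀ {S : ESet G nv} (wfS : WF S) (I : ESet G nv) (wf : WF I) → Independent I → I ⊆ S → size I ≤ nv ∸ β S wfS
  independent-size≤ wfS I wf ind sub = subst (_≤ nv ∸ β _ wfS) (sym (independent-size I wf ind))
    (ℕₚ.∸-monoʳ-≤ nv (β-mono wfS wf (λ x → root-mono sub x)))

  WF-∅ : WF ∅
  WF-∅ = (λ _ _ _ → refl) , (λ _ _ → refl)

  independent-∅ : Independent ∅
  independent-∅ = (λ { (loopC v ()) _ ; (polyC k vs inj gs ms dist) _ → true≢false (sym (ms zero)) }) ,
         (λ { (loopC v ()) _ _ _ _ ; (polyC k vs inj gs ms dist) _ _ _ _ → ⊥-elim (true≢false (sym (ms zero))) })

  count-witness : ∀ {A : Set} (p : A → Bool) xs {n} → count p xs ≡ suc n → Σ A λ x → x ∈ xs × p x ≡ true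
  count-witness p [] ()
  count-witness p (x ∷ xs) q with bool-cases (p x)
  ... | inj₁ px = x , here refl , px
  ... | inj₂ px rewrite px with count-witness p xs q
  ...   | (y , k , py) = y , there k , py

  allElts : List E
  allElts = map inj₁ allTriplesAt ++ map inj₂ (allFin nv)

  ∈-allElts : ∀ e → e ∈ allElts
  ∈-allElts (inj₁ t) with count-witness (λ x → ⌊ x ≟T t ⌋) allTriplesAt (allTriples-occurs-once t)
  ... | (x , k , q) = ∈ₚ.∈-++⁺ˡ (subst (λ z → inj₁ z ∈ map inj₁ allTriplesAt) (dec-sound (x ≟T t) q) (∈ₚ.∈-map⁺ inj₁ k))
  ∈-allElts (inj₂ v) = ∈ₚ.∈-++⁺ʳ (map inj₁ allTriplesAt) (∈ₚ.∈-map⁺ inj₂ (∈ₚ.∈-allFin v))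

  module Greedy {S : ESet G nv} (wfS : WF S) where
    GreedyResult : List E → ESet G nv → Set
    GreedyResult L I = Σ (ESet G nv) λ I' → WF I' × Independent I' × I' ⊆ S × I ⊆ I' × (∀ e → e ∈ L → mem S e ≡ true → Span I' e)

    greedy : ∀ (L : List E) (I : ESet G nv) → WF I → Independent I → I ⊆ S → GreedyResult L I
    greedy [] I wf ind sub = I , wf , ind , sub , ⊆-refl , λ e ()
    greedy (e ∷ L) I wf ind sub with bool-cases (mem S e) | span? wf e
    ... | inj₁ mS | no nsp with greedy L (insert I e) wf₁ ind₁ sub₁
      where
      notin : mem I e ≡ false
      notin = not-true (λ q → nsp (span-∈ e q))
      nd = nonDegenerate wfS e mS
      wf₁ = WF-insert wf e nd
      ind₁ = ¬span⇒independent-insert wf e nd notin ind nsp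
      sub₁ : insert I e ⊆ S
      sub₁ f q with ∨-true q
      ... | inj₁ m = sub f m
      ... | inj₂ s = trans (proj₁ wfS f e s) mS
    ...   | (I' , wf' , ind' , sub' , inc , spL) = I' , wf' , ind' , sub' , ⊆-trans (insert-⊆ e) inc ,
            λ { e' (here refl) _ → span-mono inc e (span-∈ e (insert-has I e)) ; e' (there k) m → spL e' k m }
    greedy (e ∷ L) I wf ind sub | inj₁ mS | yes sp with greedy L I wf ind sub
    ... | (I' , wf' , ind' , sub' , inc , spL) = I' , wf' , ind' , sub' , inc ,
            λ { e' (here refl) _ → span-mono inc e sp ; e' (there k) m → spL e' k m }
    greedy (e ∷ L) I wf ind sub | inj₂ nS | _ with greedy L I wf ind sub
    ... | (I' , wf' , ind' , sub' , inc , spL) = I' , wf' , ind' , sub' , inc ,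
            λ { e' (here refl) m → ⊥-elim (true≢false (trans (sym m) nS)) ; e' (there k) m → spL e' k m }

  rank-formula : ∀ (S : ESet G nv) (wf : WF S) → Rank S (nv ∸ β S wf)
  rank-formula S wf with Greedy.greedy wf allElts ∅ WF-∅ independent-∅ (λ f ())
  ... | (I' , wf' , ind' , sub' , _ , spL) =
    (I' , wf' , sub' , ind' , trans (independent-size I' wf' ind') (cong (nv ∸_) (sym beq))) ,
    (λ I wfI sub ind → independent-size≤ wf I wfI ind sub)
    where
    beq : β S wf ≡ β I' wf'
    beq = SpanInvariance.β-eq wf' wf sub' (λ f m → spL f (∈-allElts f) m)

  rank-unique : ∀ {S : ESet G nv} {k k'} → Rank S k → Rank S k' → k ≡ k'
  rank-unique ((I , wf , sub , ind , sz) , mx) ((I' , wf' , sub' , ind' , sz') , mx') =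
    ℕₚ.≤-antisym (subst (_≤ _) sz (mx' I wf sub ind)) (subst (_≤ _) sz' (mx I' wf' sub' ind'))

  span-resp : ∀ {Z : ESet G nv} → WF Z → ∀ e f → sameEdge f e ≡ true → Span Z e → Span Z f
  span-resp wf (inj₂ v) (inj₂ v') s sp with ⌊≟⌋-sound v' v s
  ... | refl = sp
  span-resp wf (inj₁ (u , v , h)) (inj₁ (a , b , g)) s sp with sameEdge-ends a b g u v h s
  ... | inj₁ (refl , refl , refl) = sp
  span-resp {Z} wf (inj₁ (u , v , h)) (inj₁ (a , b , g)) s sp | inj₂ (refl , refl , q) with sp
  ... | inj₁ (ua , va) = inj₁ (va , ua)
  ... | inj₂ (inj₁ (w , ua)) = inj₂ (inj₁ (rev wf w , unbalanced-transport wf (rev wf w) ua))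
  ... | inj₂ (inj₂ (w , gw)) = inj₂ (inj₂ (rev wf w , trans (gain-rev wf w) (trans (cong inv gw) (sym q))))
  span-resp wf (inj₁ _) (inj₂ _) () sp
  span-resp wf (inj₂ _) (inj₁ _) () sp

  module Closure {Z : ESet G nv} (wfZ : WF Z) (e : E) (nd : NonDegenerate e) where
    Ze = insert Z e
    wfZe : WF Ze
    wfZe = WF-insert wfZ e nd

    span⇒inClosure : Span Z e → InClosure Z e
    span⇒inClosure sp k rk = subst (Rank Ze) (trans (cong (nv ∸_) beq) (rank-unique (rank-formula Z wfZ) rk)) (rank-formula Ze wfZe)
      where
      allSp : ∀ f → mem Ze f ≡ true → Span Z f
      allSp f m with ∨-true m
      ... | inj₁ mz = span-∈ f mz
      ... | inj₂ s = span-resp wfZ e f s sp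
      beq : β Ze wfZe ≡ β Z wfZ
      beq = SpanInvariance.β-eq wfZ wfZe (insert-⊆ e) allSp

    inClosure⇒span : InClosure Z e → mem Z e ≡ false → Span Z e
    inClosure⇒span ic notin with span? wfZ e
    ... | yes sp = sp
    ... | no nsp = ⊥-elim (neq (rank-unique (ic _ (rank-formula Z wfZ)) (rank-formula Ze wfZe)))
      where
      bs : β Z wfZ ≡ suc (β Ze wfZe)
      bs = trans (β-insert wfZ e nd notin nsp) (cong suc (β-irrelevant _ _))
      neq : nv ∸ β Z wfZ ≢ nv ∸ β Ze wfZe
      neq q = ℕₚ.1+n≢n (trans (sym bs) (ℕₚ.∸-cancelˡ-≡ (β-≤ Z wfZ) (β-≤ Ze wfZe) q))

module CompleteInducedSubgraph {G : FinGroup} {nv : ℕ} (Γ : GainGraph G nv) (W : Fin nv → Bool)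
       (hloop : ∀ v → W v ≡ true → mem (elts Γ) (inj₂ v) ≡ true)
       (hedge : ∀ u v (g : Carrier G) → W u ≡ true → W v ≡ true → u ≢ v → mem (elts Γ) (inj₁ (u , v , g)) ≡ true) where
  open GroupLemmas G
  open EdgeSets G nv
  open Walks G nv

  -- Vertices of W come first, so the root of a component meeting W lies in W.
  key : Fin nv → ℕ
  key v = (if W v then 0 else nv) + toℕ v

  key-injective : ∀ a b → key a ≡ key b → a ≡ b
  key-injective a b q with W a | W b
  ... | true | true = Finₚ.toℕ-injective q
  ... | false | false = Finₚ.toℕ-injective (ℕₚ.+-cancelˡ-≡ nv _ _ q)
  ... | true | false = ⊥-elim (ℕₚ.<⇒≱ (Finₚ.toℕ<n a) (subst (nv ≤_) (sym q) (ℕₚ.m≤m+n nv _)))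
  ... | false | true = ⊥-elim (ℕₚ.<⇒≱ (Finₚ.toℕ<n b) (subst (nv ≤_) q (ℕₚ.m≤m+n nv _)))

  key-W<key-out : ∀ a b → W a ≡ true → W b ≡ false → key a < key b
  key-W<key-out a b wa wb rewrite wa | wb = ℕₚ.<-≤-trans (Finₚ.toℕ<n a) (ℕₚ.m≤m+n nv _)

  open BalancedRoots G nv key key-injective
  open RankFormula G nv key key-injective

  Γs = elts Γ
  wfΓ : WF Γs
  wfΓ = eltsWF Γ
  X = inducedElts Γ W

  memX-edge : ∀ a b g → mem X (inj₁ (a , b , g)) ≡ true → W a ≡ true × W b ≡ true × mem Γs (inj₁ (a , b , g)) ≡ true
  memX-edge a b g p with ∧-true p
  ... | (wa , q) with ∧-true q
  ... | (wb , m) = wa , wb , m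

  memX-loop : ∀ v → mem X (inj₂ v) ≡ true → W v ≡ true × mem Γs (inj₂ v) ≡ true
  memX-loop v p = ∧-true p

  X⊆Γ : X ⊆ Γs
  X⊆Γ (inj₁ (a , b , g)) p = proj₂ (proj₂ (memX-edge a b g p))
  X⊆Γ (inj₂ v) p = proj₂ (memX-loop v p)

  WF-X : WF X
  WF-X = resp , nd
    where
    resp : ∀ f f' → sameEdge f f' ≡ true → mem X f ≡ mem X f'
    resp (inj₁ (a , b , g)) (inj₁ (a' , b' , g')) s with sameEdge-ends a b g a' b' g' s
    ... | inj₁ (refl , refl , refl) = refl
    ... | inj₂ (refl , refl , q) = trans (cong (W a ∧_) (cong (W b ∧_) (proj₁ wfΓ _ _ s)))
            (trans (sym (Boolₚ.∧-assoc (W a) (W b) _))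
              (trans (cong (_∧ _) (Boolₚ.∧-comm (W a) (W b))) (Boolₚ.∧-assoc (W b) (W a) _)))
    resp (inj₂ v) (inj₂ v') s with ⌊≟⌋-sound v v' s
    ... | refl = refl
    resp (inj₁ _) (inj₂ _) ()
    resp (inj₂ _) (inj₁ _) ()
    nd : ∀ u g → mem X (inj₁ (u , u , g)) ≡ false
    nd u g = trans (cong (λ z → W u ∧ W u ∧ z) (proj₂ wfΓ u g)) (trans (cong (W u ∧_) (Boolₚ.∧-zeroʳ (W u))) (Boolₚ.∧-zeroʳ (W u)))

  walkX-ends : ∀ {a b} → Walk X a b → a ≡ b ⊎ (W a ≡ true × W b ≡ true)
  walkX-ends [] = inj₁ refl
  walkX-ends {a} (st y g p w) with memX-edge a y g p | walkX-ends w
  ... | (wa , wy , _) | inj₁ refl = inj₂ (wa , wy)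
  ... | (wa , wy , _) | inj₂ (_ , wb) = inj₂ (wa , wb)

  rootX-outside : ∀ x → W x ≡ false → Root X x
  rootX-outside x wx = nb , mn
    where
    nb : ¬ Unbalanced X x
    nb (inj₁ (y , w , l)) with walkX-ends w
    ... | inj₁ refl = true≢false (trans (sym (proj₁ (memX-loop x l))) wx)
    ... | inj₂ (wx' , _) = true≢false (trans (sym wx') wx)
    nb (inj₂ ([] , nt)) = nt refl
    nb (inj₂ (st y g p w , nt)) = true≢false (trans (sym (proj₁ (memX-edge x y g p))) wx)
    mn : Minimal X x
    mn w lt Wk with walkX-ends Wk
    ... | inj₁ refl = ℕₚ.<-irrefl refl lt
    ... | inj₂ (_ , wx') = true≢false (trans (sym wx') wx)

  unbalancedX-inside : ∀ {S : ESet G nv} → X ⊆ S → ∀ x → W x ≡ true → Unbalanced S x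
  unbalancedX-inside sub x wx = inj₁ (x , [] , sub _ (∧-intro wx (hloop x wx)))

  ¬span-X : ∀ e → mem Γs e ≡ true → mem X e ≡ false → ¬ Span X e
  ¬span-X (inj₂ v) me nx sp = proj₁ (rootX-outside v (∧-false-left (W v) _ nx me)) sp
  ¬span-X (inj₁ (u , v , h)) me nx sp with bool-cases (W u) | bool-cases (W v)
  ... | inj₁ wu | inj₁ wv = true≢false (trans (sym (∧-intro wu (∧-intro wv me))) nx)
  ... | inj₂ wu | _ = caseU sp
    where
    caseU : Span X (inj₁ (u , v , h)) → ⊥
    caseU (inj₁ (ua , _)) = proj₁ (rootX-outside u wu) ua
    caseU (inj₂ (inj₁ (_ , ua))) = proj₁ (rootX-outside u wu) ua
    caseU (inj₂ (inj₂ (w , _))) with walkX-ends w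
    ... | inj₁ refl = true≢false (trans (sym me) (proj₂ wfΓ u h))
    ... | inj₂ (wu' , _) = true≢false (trans (sym wu') wu)
  ... | inj₁ _ | inj₂ wv = caseV sp
    where
    caseV : Span X (inj₁ (u , v , h)) → ⊥
    caseV (inj₁ (_ , va)) = proj₁ (rootX-outside v wv) va
    caseV (inj₂ (inj₁ (w , _))) with walkX-ends w
    ... | inj₁ refl = true≢false (trans (sym me) (proj₂ wfΓ u h))
    ... | inj₂ (_ , wv') = true≢false (trans (sym wv') wv)
    caseV (inj₂ (inj₂ (w , _))) with walkX-ends w
    ... | inj₁ refl = true≢false (trans (sym me) (proj₂ wfΓ u h))
    ... | inj₂ (_ , wv') = true≢false (trans (sym wv') wv)

  flat-X : Flat Γ X
  flat-X = WF-X , X⊆Γ , cl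
    where
    cl : ∀ e → mem Γs e ≡ true → InClosure X e → mem X e ≡ true
    cl e me ic with bool-cases (mem X e)
    ... | inj₁ q = q
    ... | inj₂ nx = ⊥-elim (¬span-X e me nx (Closure.inClosure⇒span WF-X e (nonDegenerate wfΓ e me) ic nx))

  module WithFlat (Y : ESet G nv) (fY : Flat Γ Y) where
    wfY : WF Y
    wfY = proj₁ fY
    Y⊆Γ : Y ⊆ Γs
    Y⊆Γ = proj₁ (proj₂ fY)
    I = X ∩ Y
    U = X ∪ Y
    wfI : WF I
    wfI = WF-∩ WF-X wfY
    wfU : WF U
    wfU = WF-∪ WF-X wfY
    I⊆X : I ⊆ X
    I⊆X f p = proj₁ (∧-true p)
    I⊆Y : I ⊆ Y
    I⊆Y f p = proj₂ (∧-true p)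
    X⊆U : X ⊆ U
    X⊆U f p = ∨-introˡ _ p
    Y⊆U : Y ⊆ U
    Y⊆U f p = ∨-introʳ (mem X f) p

    inY : ∀ e → mem Γs e ≡ true → Span Y e → mem Y e ≡ true
    inY e me sp = proj₂ (proj₂ fY) e me (Closure.span⇒inClosure wfY e (nonDegenerate wfΓ e me) sp)

    rootY-inside : ∀ x → W x ≡ true → Root I x → Root Y x
    rootY-inside x wx (nb , mn) = nbY , mnY
      where
      nbY : ¬ Unbalanced Y x
      nbY uy = nb (inj₁ (x , [] , ∧-intro (∧-intro wx (hloop x wx)) (inY (inj₂ x) (hloop x wx) uy)))
      mnY : Minimal Y x
      mnY w lt Wk with bool-cases (W w) | w ≟ x
      ... | _ | yes refl = ℕₚ.<-irrefl refl lt
      ... | inj₂ ww | no _ = ℕₚ.<-asym lt (key-W<key-out x w wx ww)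
      ... | inj₁ ww | no ne = mn w lt (st x (gain Wk) mI [])
        where
        eΓ = hedge w x (gain Wk) ww wx ne
        mI : mem I (inj₁ (w , x , gain Wk)) ≡ true
        mI = ∧-intro (∧-intro ww (∧-intro wx eΓ)) (inY _ eΓ (inj₂ (inj₂ (Wk , refl))))

    module RootY-outside (x : V) (wx : W x ≡ false) (rY : Root Y x) where
      avoids-W : ∀ {y} → Walk Y x y → W y ≡ false
      avoids-W {y} Wk with bool-cases (W y)
      ... | inj₂ q = q
      ... | inj₁ wy = ⊥-elim (proj₂ rY y (key-W<key-out y x wy wx) (rev wfY Wk))

      walkInY : ∀ {a b} → Walk Y x a → (Wk : Walk U a b) → Σ (Walk Y a b) λ W' → gain W' ≡ gain Wk
      walkInY pre [] = [] , refl
      walkInY {a} pre (st y g p Wk) with ∨-true p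
      ... | inj₁ mX = ⊥-elim (true≢false (trans (sym (proj₁ (memX-edge a y g mX))) (avoids-W pre)))
      ... | inj₂ mY with walkInY (pre ++W st y g mY []) Wk
      ...   | (W' , gq) = st y g mY W' , cong (g ·_) gq

      root-U : Root U x
      root-U = nb , mn
        where
        nb : ¬ Unbalanced U x
        nb (inj₁ (y , Wk , l)) with ∨-true l
        ... | inj₁ lX = true≢false (trans (sym (proj₁ (memX-loop y lX))) (avoids-W (proj₁ (walkInY [] Wk))))
        ... | inj₂ lY = proj₁ rY (inj₁ (y , proj₁ (walkInY [] Wk) , lY))
        nb (inj₂ (c , nt)) = proj₁ rY (inj₂ (proj₁ (walkInY [] c) , λ q → nt (trans (sym (proj₂ (walkInY [] c))) q)))
        mn : Minimal U x
        mn w lt Wk = proj₂ rY w lt (rev wfY (proj₁ (walkInY [] (rev wfU Wk))))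

    root-count-pointwise : ∀ x → (if ⌊ root? WF-X x ⌋ then 1 else 0) + (if ⌊ root? wfY x ⌋ then 1 else 0)
                     ≡ (if ⌊ root? wfI x ⌋ then 1 else 0) + (if ⌊ root? wfU x ⌋ then 1 else 0)
    root-count-pointwise x with bool-cases (W x)
    ... | inj₁ wx rewrite dec-false (root? WF-X x) (λ r → proj₁ r (unbalancedX-inside ⊆-refl x wx))
                        | dec-false (root? wfU x) (λ r → proj₁ r (unbalancedX-inside X⊆U x wx))
                        | dec-agree (root? wfY x) (root? wfI x) (root-mono I⊆Y x) (rootY-inside x wx) = ℕₚ.+-comm 0 _
    ... | inj₂ wx rewrite dec-true (root? WF-X x) (rootX-outside x wx)
                        | dec-true (root? wfI x) (root-mono I⊆X x (rootX-outside x wx))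
                        | dec-agree (root? wfY x) (root? wfU x) (RootY-outside.root-U x wx) (root-mono Y⊆U x) = refl

    β-modular : β X WF-X + β Y wfY ≡ β I wfI + β U wfU
    β-modular = count-+-pointwise _ _ _ _ root-count-pointwise (allFin nv)

    module WithClosure (C : ESet G nv) (isC : IsClosure Γ U C) where
      wfC : WF C
      wfC = proj₁ isC
      C⊆Γ : C ⊆ Γs
      C⊆Γ = proj₁ (proj₂ isC)
      U⊆Γ : U ⊆ Γs
      U⊆Γ f p with ∨-true p
      ... | inj₁ q = X⊆Γ f q
      ... | inj₂ q = Y⊆Γ f q
      U⊆C : U ⊆ C
      U⊆C f m = proj₂ (proj₂ (proj₂ isC) f (U⊆Γ f m)) (Closure.span⇒inClosure wfU f (nonDegenerate wfU f m) (span-∈ f m))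
      spC : ∀ f → mem C f ≡ true → Span U f
      spC f m with bool-cases (mem U f)
      ... | inj₁ q = span-∈ f q
      ... | inj₂ nq = Closure.inClosure⇒span wfU f (nonDegenerate wfC f m) (proj₁ (proj₂ (proj₂ isC) f (C⊆Γ f m)) m) nq
      β-closure : β C wfC ≡ β U wfU
      β-closure = SpanInvariance.β-eq wfU wfC U⊆C spC

      rank-modular : ∀ a b c d → Rank X a → Rank Y b → Rank I c → Rank C d → a + b ≡ c + d
      rank-modular a b c d rX rY rI rC =
        subst₂ (λ p q → p ≡ q) (cong₂ _+_ (rank-unique (rank-formula X WF-X) rX) (rank-unique (rank-formula Y wfY) rY))
               (cong₂ _+_ (rank-unique (rank-formula I wfI) rI) (rank-unique (rank-formula C wfC) rC))
          (trans (∸-modular nv _ _ _ _ (β-≤ X WF-X) (β-≤ Y wfY) (β-≤ I wfI) (β-≤ U wfU) β-modular)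
                 (cong (λ z → (nv ∸ β I wfI) + (nv ∸ z)) (sym β-closure)))

proposition4p7 : {G : FinGroup} {nv : ℕ} (Γ : GainGraph G nv) (W : Fin nv → Bool) (n : ℕ)
    → countV W ≡ n
    → (∀ v → W v ≡ true → mem (elts Γ) (inj₂ v) ≡ true)
    → (∀ u v (g : Carrier G) → W u ≡ true → W v ≡ true → u ≢ v → mem (elts Γ) (inj₁ (u , v , g)) ≡ true)
    → Modular Γ (inducedElts Γ W)
proposition4p7 Γ W n _ hloop hedge = flat-X , rank-modular
  where
  open CompleteInducedSubgraph Γ W hloop hedge
  rank-modular : ∀ Y → Flat Γ Y → ∀ C → IsClosure Γ (X ∪ Y) C → ∀ a b c d →
                 Rank X a → Rank Y b → Rank (X ∩ Y) c → Rank C d → a + b ≡ c + d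
  rank-modular Y flatY C closureC = WithFlat.WithClosure.rank-modular Y flatY C closureC
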